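{- Let $m \geq 3$ and $l_1\le\cdots\le l_m$ be natural numbers with $l_1 \geq 2$ and $l_2 \geq 4$. Then $[\Theta(l_1,\ldots,l_m)]^2$ is equitably $k$-choosable for every $k \geq m+3$.
   Context: $\Theta(l_1,\ldots,l_m)$ denotes a generalized theta graph: two vertices $u,w$ joined by $m$ internally disjoint paths, the $i$th being $u, v_{i,1},\ldots,v_{i,l_i-1}, w$ (length $l_i$). $G^2$ is the square of $G$ (two vertices adjacent iff at distance at most 2 in $G$). A $k$-assignment $L$ assigns to each vertex a list of exactly $k$ colors; an equitable $L$-coloring of a graph $G$ is a proper coloring $f$ with $f(v)\in L(v)$ using each color at most $\lceil |V(G)|/k\rceil$ times; $G$ is equitably $k$-choosable if it has an equitable $L$-coloring for every $k$-assignment $L$. -}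

module Defs where

open import Data.Nat using (ℕ; zero; suc; _+_; _∸_; _≤_)
open import Data.Nat.DivMod using (_/_)
open import Data.Fin using (Fin; toℕ)
open import Data.List using (List; []; _∷_; length; filter; map; concatMap; allFin)
open import Data.List.Membership.Propositional using (_∈_)
open import Data.List.Relation.Unary.AllPairs using (AllPairs)
open import Data.Product using (Σ; _×_; ∃)
open import Data.Sum using (_⊎_)
open import Relation.Binary.PropositionalEquality using (_≡_; _≢_)
open import Data.Nat.Properties using (_≟_)

-- ⌈ n / k ⌉ ; the value for k = 0 is irrelevant (k ≥ 6 in the theorem)
⌈_/_⌉ : ℕ → ℕ → ℕ
⌈ n / zero ⌉  = 0
⌈ n / suc k ⌉ = (n + k) / suc k

-- A finite (simple) graph: vertex type, adjacency relation, and a list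
-- enumerating every vertex exactly once.
record FinGraph : Set₁ where
  field
    V     : Set
    Adj   : V → V → Set
    verts : List V

open FinGraph

square : FinGraph → FinGraph
square G = record
  { V = V G
  ; Adj = λ x y → x ≢ y × (Adj G x y ⊎ Σ (V G) λ z → Adj G x z × Adj G z y)
  ; verts = verts G }

colourCount : {A : Set} → List A → (A → ℕ) → ℕ → ℕ
colourCount vs f c = length (filter (λ v → f v ≟ c) vs)

IsKAssignment : (G : FinGraph) → ℕ → (V G → List ℕ) → Set
IsKAssignment G k L = ∀ v → length (L v) ≡ k × AllPairs _≢_ (L v)

IsEquitableLColouring : (G : FinGraph) → ℕ → (V G → List ℕ) → (V G → ℕ) → Set
IsEquitableLColouring G k L f =
  (∀ v → f v ∈ L v) ×
  (∀ x y → Adj G x y → f x ≢ f y) ×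
  (∀ c → colourCount (verts G) f c ≤ ⌈ length (verts G) / k ⌉)

EquitablyChoosable : FinGraph → ℕ → Set
EquitablyChoosable G k =
  (L : V G → List ℕ) → IsKAssignment G k L →
  ∃ λ f → IsEquitableLColouring G k L f

-- Generalized theta graph Θ(l₀,…,l_{m-1}) (0-indexed paths).
-- Path i is u, inner i 0, …, inner i (l i ∸ 2), w.
data ThetaV (m : ℕ) (l : Fin m → ℕ) : Set where
  tu tw : ThetaV m l
  inner : (i : Fin m) → Fin (l i ∸ 1) → ThetaV m l

data ThetaEdge (m : ℕ) (l : Fin m → ℕ) : ThetaV m l → ThetaV m l → Set where
  direct : (i : Fin m) → l i ≡ 1 → ThetaEdge m l tu tw
  first  : (i : Fin m) (j : Fin (l i ∸ 1)) → toℕ j ≡ 0 → ThetaEdge m l tu (inner i j)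
  step   : (i : Fin m) (j j′ : Fin (l i ∸ 1)) → suc (toℕ j) ≡ toℕ j′ →
           ThetaEdge m l (inner i j) (inner i j′)
  last   : (i : Fin m) (j : Fin (l i ∸ 1)) → suc (toℕ j) ≡ l i ∸ 1 →
           ThetaEdge m l (inner i j) tw

Theta : (m : ℕ) → (Fin m → ℕ) → FinGraph
Theta m l = record
  { V = ThetaV m l
  ; Adj = λ x y → ThetaEdge m l x y ⊎ ThetaEdge m l y x
  ; verts = tu ∷ tw ∷ concatMap (λ i → map (inner i) (allFin (l i ∸ 1))) (allFin m) }

module Submission where

-- The proof is by greedy list colouring along a "block schedule": every vertex
-- gets a slot (block, offset) with offset < k, distinct vertices get distinct
-- slots, and each vertex has fewer than k ∸ offset neighbours in earlier
-- blocks.  Colouring the vertices in slot order, each one avoiding its earlier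
-- neighbours and the earlier vertices of its own block, never runs out of
-- colours, and a colour is used at most once per block; so a schedule with at
-- most ⌈ n / k ⌉ blocks gives an equitable colouring (schedule⇒equitablyChoosable).

open import Defs
open import Data.Nat
open import Data.Nat.Properties
open import Data.Nat.DivMod
open import Data.Nat.Induction using (<-wellFounded)
open import Data.Nat.Solver using (module +-*-Solver)
open import Induction.WellFounded using (Acc; acc)
open import Data.Fin using (Fin; zero; suc; toℕ; fromℕ<)
open import Data.Fin.Properties using (toℕ<n; toℕ-injective; toℕ-fromℕ<; fromℕ<-toℕ)
open import Data.List hiding (lookup; find)
open import Data.List.Properties
open import Data.List.Membership.Propositional using (_∈_; _∉_; mapWith∈; find)
open import Data.List.Membership.Propositional.Properties
open import Data.List.Relation.Unary.Any using (here; there; any?)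
open import Data.List.Relation.Unary.All using (All; []; _∷_; all?)
import Data.List.Relation.Unary.All as All
open import Data.List.Relation.Unary.All.Properties using (¬All⇒Any¬; all-filter)
open import Data.List.Relation.Unary.AllPairs using (AllPairs; []; _∷_)
import Data.List.Relation.Unary.AllPairs.Properties as AP
open import Data.Product using (Σ; ∃; _×_; _,_; proj₁; proj₂)
open import Data.Sum using (_⊎_; inj₁; inj₂; swap)
open import Data.Empty using (⊥; ⊥-elim)
open import Data.Unit using (⊤; tt)
open import Function using (_∘_; id)
open import Relation.Nullary
open import Relation.Nullary.Decidable using (_×-dec_)
open import Relation.Binary.PropositionalEquality hiding ([_])
open import Relation.Binary.Definitions using (tri<; tri≈; tri>)

open FinGraph using (V; Adj; verts)

sumFin : ∀ {n} → (Fin n → ℕ) → ℕ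
sumFin {zero}  h = 0
sumFin {suc n} h = h zero + sumFin (h ∘ suc)

-- The prefix sum h 0 + … + h (i-1); it encodes the pairs (i , t) with t < h i
-- injectively as the numbers below sumFin h.
prefixSum : ∀ {n} → (Fin n → ℕ) → Fin n → ℕ
prefixSum h zero    = 0
prefixSum h (suc i) = h zero + prefixSum (h ∘ suc) i

sumFin-cong : ∀ {n} {f g : Fin n → ℕ} → (∀ i → f i ≡ g i) → sumFin f ≡ sumFin g
sumFin-cong {zero}  _  = refl
sumFin-cong {suc n} eq = cong₂ _+_ (eq zero) (sumFin-cong (eq ∘ suc))

sumFin-const1 : ∀ n → sumFin {n} (λ _ → 1) ≡ n
sumFin-const1 zero    = refl
sumFin-const1 (suc n) = cong suc (sumFin-const1 n)

sumFin-+ : ∀ {n} (f g : Fin n → ℕ) → sumFin (λ i → f i + g i) ≡ sumFin f + sumFin g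
sumFin-+ {zero}  f g = refl
sumFin-+ {suc n} f g = begin
    f zero + g zero + sumFin (λ i → f (suc i) + g (suc i))
      ≡⟨ cong (f zero + g zero +_) (sumFin-+ (f ∘ suc) (g ∘ suc)) ⟩
    f zero + g zero + (sumFin (f ∘ suc) + sumFin (g ∘ suc))
      ≡⟨ +-*-Solver.solve 4 (λ a b x y → (a :+ b) :+ (x :+ y) := (a :+ x) :+ (b :+ y))
           refl (f zero) (g zero) (sumFin (f ∘ suc)) (sumFin (g ∘ suc)) ⟩
    f zero + sumFin (f ∘ suc) + (g zero + sumFin (g ∘ suc)) ∎
  where open ≡-Reasoning
        open +-*-Solver using (_:+_; _:=_)

prefixSum+term≤sum : ∀ {n} (h : Fin n → ℕ) i → prefixSum h i + h i ≤ sumFin h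
prefixSum+term≤sum h zero    = m≤m+n (h zero) _
prefixSum+term≤sum h (suc i) = begin
    h zero + prefixSum (h ∘ suc) i + h (suc i)   ≡⟨ +-assoc (h zero) _ _ ⟩
    h zero + (prefixSum (h ∘ suc) i + h (suc i)) ≤⟨ +-monoʳ-≤ (h zero) (prefixSum+term≤sum (h ∘ suc) i) ⟩
    h zero + sumFin (h ∘ suc)                    ∎
  where open ≤-Reasoning

prefixSum-injective : ∀ {n} (h : Fin n → ℕ) i i′ t t′ → t < h i → t′ < h i′ →
  prefixSum h i + t ≡ prefixSum h i′ + t′ → i ≡ i′ × t ≡ t′
prefixSum-injective h zero    zero     t t′ _  _   eq = refl , eq
prefixSum-injective h zero    (suc i′) t t′ lt _   eq =
  ⊥-elim (<⇒≱ lt (≤-trans (≤-trans (m≤m+n (h zero) _) (m≤m+n _ t′)) (≤-reflexive (sym eq))))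
prefixSum-injective h (suc i) zero     t t′ _  lt′ eq =
  ⊥-elim (<⇒≱ lt′ (≤-trans (≤-trans (m≤m+n (h zero) _) (m≤m+n _ t)) (≤-reflexive eq)))
prefixSum-injective h (suc i) (suc i′) t t′ lt lt′ eq
  with prefixSum-injective (h ∘ suc) i i′ t t′ lt lt′
         (+-cancelˡ-≡ (h zero) _ _ (trans (sym (+-assoc (h zero) _ t)) (trans eq (+-assoc (h zero) _ t′))))
... | refl , t≡t′ = refl , t≡t′

-- Decoding of the prefix-sum encoding: locate h d g (prefixSum h i + t) = g i t
-- whenever t < h i (d is a default value for numbers ≥ sumFin h).
locate : ∀ {n} (h : Fin n → ℕ) {B : Set} (d : B) (g : Fin n → ℕ → B) → ℕ → B
locate {zero}  h d g c = d
locate {suc n} h d g c with c <? h zero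
... | yes _ = g zero c
... | no  _ = locate (h ∘ suc) d (g ∘ suc) (c ∸ h zero)

locate-prefixSum : ∀ {n} (h : Fin n → ℕ) {B : Set} (d : B) g (i : Fin n) t → t < h i →
  locate h d g (prefixSum h i + t) ≡ g i t
locate-prefixSum h d g zero t lt with t <? h zero
... | yes _ = refl
... | no ¬lt = ⊥-elim (¬lt lt)
locate-prefixSum h d g (suc i) t lt with h zero + prefixSum (h ∘ suc) i + t <? h zero
... | yes small = ⊥-elim (<⇒≱ small (≤-trans (m≤m+n (h zero) _) (m≤m+n _ t)))
... | no _ = trans (cong (locate (h ∘ suc) d (g ∘ suc)) shift)
                   (locate-prefixSum (h ∘ suc) d (g ∘ suc) i t lt)
  where
  shift : h zero + prefixSum (h ∘ suc) i + t ∸ h zero ≡ prefixSum (h ∘ suc) i + t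
  shift = trans (cong (_∸ h zero) (+-assoc (h zero) _ t)) (m+n∸m≡n (h zero) _)

concat-map-allFin-suc : ∀ {A : Set} n (g : Fin (suc n) → List A) →
  concat (map g (allFin (suc n))) ≡ g zero ++ concat (map (g ∘ suc) (allFin n))
concat-map-allFin-suc n g = cong (λ xss → g zero ++ concat xss)
  (trans (map-tabulate suc g) (sym (map-tabulate id (g ∘ suc))))

length-concat-map-allFin : ∀ {A : Set} {n} (g : Fin n → List A) →
  length (concat (map g (allFin n))) ≡ sumFin (λ i → length (g i))
length-concat-map-allFin {n = zero}  g = refl
length-concat-map-allFin {n = suc n} g rewrite concat-map-allFin-suc n g =
  trans (length-++ (g zero)) (cong (length (g zero) +_) (length-concat-map-allFin (g ∘ suc)))

∈-concat-map-allFin : ∀ {A : Set} {n} (g : Fin n → List A) i {y} → y ∈ g i → y ∈ concat (map g (allFin n))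
∈-concat-map-allFin g i y∈ = ∈-concat⁺′ y∈ (∈-map⁺ g (∈-allFin i))

module _ {k : ℕ} .{{_ : NonZero k}} where

  div-between : ∀ x q → q * k ≤ x → x < suc q * k → x / k ≡ q
  div-between x q qk≤x x<[1+q]k = ≤-antisym (≤-pred (m<n*o⇒m/o<n x<[1+q]k))
    (≤-trans (≤-reflexive (sym (m*n/n≡m q k))) (/-monoˡ-≤ k qk≤x))

  div-sub : ∀ r d → d ≤ r % k → (r ∸ d) / k ≡ r / k
  div-sub r d d≤r%k = div-between (r ∸ d) (r / k) lower upper
    where
    r≡ : r ≡ r % k + r / k * k
    r≡ = m≡m%n+[m/n]*n r k
    lower : r / k * k ≤ r ∸ d
    lower = begin
        r / k * k                 ≡⟨ sym (m+n∸m≡n (r % k) _) ⟩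
        r % k + r / k * k ∸ r % k ≤⟨ ∸-monoʳ-≤ (r % k + r / k * k) d≤r%k ⟩
        r % k + r / k * k ∸ d     ≡⟨ cong (_∸ d) (sym r≡) ⟩
        r ∸ d                     ∎
      where open ≤-Reasoning
    upper : r ∸ d < suc (r / k) * k
    upper = begin-strict
        r ∸ d             ≤⟨ m∸n≤m r d ⟩
        r                 ≡⟨ r≡ ⟩
        r % k + r / k * k <⟨ +-monoˡ-< (r / k * k) (m%n<n r k) ⟩
        suc (r / k) * k   ∎
      where open ≤-Reasoning

module Counting {A : Set} {P : A → Set} (P? : ∀ x → Dec (P x)) where

  count : List A → ℕ
  count xs = length (filter P? xs)

  count-++ : ∀ xs ys → count (xs ++ ys) ≡ count xs + count ys
  count-++ xs ys = trans (cong length (filter-++ P? xs ys)) (length-++ (filter P? xs))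

  count≤length : ∀ xs → count xs ≤ length xs
  count≤length xs = length-filter P? xs

  count-reject : ∀ x xs → ¬ P x → count (x ∷ xs) ≡ count xs
  count-reject x xs ¬px = cong length (filter-reject P? ¬px)

  count-none : ∀ xs → (∀ {x} → x ∈ xs → ¬ P x) → count xs ≡ 0
  count-none []       _    = refl
  count-none (x ∷ xs) none =
    trans (count-reject x xs (none (here refl))) (count-none xs (none ∘ there))

  count-concat-map-allFin : ∀ {n} (g : Fin n → List A) → (∀ i → count (g i) ≤ 1) →
    count (concat (map g (allFin n))) ≤ n
  count-concat-map-allFin {zero}  g _ = z≤n
  count-concat-map-allFin {suc n} g ≤1
    rewrite concat-map-allFin-suc n g | count-++ (g zero) (concat (map (g ∘ suc) (allFin n))) =
    +-mono-≤ (≤1 zero) (count-concat-map-allFin (g ∘ suc) (≤1 ∘ suc))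

  count-map-allFin : ∀ {n} (g : Fin (suc n) → A) → ¬ P (g zero) → count (map g (allFin (suc n))) ≤ n
  count-map-allFin {n} g ¬p0 = begin
      count (g zero ∷ map g (tabulate suc)) ≡⟨ count-reject (g zero) _ ¬p0 ⟩
      count (map g (tabulate suc))          ≤⟨ count≤length (map g (tabulate {n = n} suc)) ⟩
      length (map g (tabulate {n = n} suc)) ≡⟨ length-map g (tabulate suc) ⟩
      length (tabulate {n = n} suc)         ≡⟨ length-tabulate suc ⟩
      n                                     ∎
    where open ≤-Reasoning

open Counting

remove : ℕ → List ℕ → List ℕ
remove x [] = []
remove x (y ∷ ys) with x ≟ y
... | yes _ = ys
... | no  _ = y ∷ remove x ys

length-remove : ∀ x ys → x ∈ ys → suc (length (remove x ys)) ≡ length ys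
length-remove x (y ∷ ys) (here refl) with x ≟ x
... | yes _ = refl
... | no x≢x = ⊥-elim (x≢x refl)
length-remove x (y ∷ ys) (there x∈) with x ≟ y
... | yes _ = refl
... | no  _ = cong suc (length-remove x ys x∈)

∈-remove : ∀ x z ys → z ≢ x → z ∈ ys → z ∈ remove x ys
∈-remove x z (y ∷ ys) z≢x (here refl) with x ≟ y
... | yes refl = ⊥-elim (z≢x refl)
... | no  _    = here refl
∈-remove x z (y ∷ ys) z≢x (there z∈) with x ≟ y
... | yes _ = z∈
... | no  _ = there (∈-remove x z ys z≢x z∈)

unique-⊆⇒length≤ : ∀ {xs ys : List ℕ} → AllPairs _≢_ xs → (∀ {x} → x ∈ xs → x ∈ ys) →
  length xs ≤ length ys
unique-⊆⇒length≤ {[]}     _            _   = z≤n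
unique-⊆⇒length≤ {x ∷ xs} {ys} (x∉ ∷ u) sub =
  subst (suc (length xs) ≤_) (length-remove x ys (sub (here refl)))
    (s≤s (unique-⊆⇒length≤ u (λ {z} z∈ → ∈-remove x z ys
       (λ z≡x → All.lookup x∉ z∈ (sym z≡x)) (sub (there z∈)))))

unique-below⇒length≤ : ∀ {xs : List ℕ} n → AllPairs _≢_ xs → (∀ {x} → x ∈ xs → x < n) → length xs ≤ n
unique-below⇒length≤ {xs} n u below = begin
    length xs      ≤⟨ unique-⊆⇒length≤ u (∈-upTo⁺ ∘ below) ⟩
    length (upTo n) ≡⟨ length-upTo n ⟩
    n              ∎
  where open ≤-Reasoning

AllPairs-strengthen : ∀ {A : Set} {P : A → Set} {R S : A → A → Set} →
  (∀ {a b} → P a → P b → R a b → S a b) → ∀ {xs} → All P xs → AllPairs R xs → AllPairs S xs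
AllPairs-strengthen f []         []       = []
AllPairs-strengthen f (pa ∷ pas) (r ∷ rs) = All.zipWith (λ (pb , rab) → f pa pb rab) (pas , r)
                                             ∷ AllPairs-strengthen f pas rs

-- The first colour of L that does not occur in F (0 if there is none).
pick : List ℕ → List ℕ → ℕ
pick []       F = 0
pick (c ∷ cs) F with any? (c ≟_) F
... | yes _ = pick cs F
... | no  _ = c

pick-avoids : ∀ L F → (∃ λ c → c ∈ L × c ∉ F) → pick L F ∈ L × pick L F ∉ F
pick-avoids (c ∷ cs) F (d , d∈ , d∉) with any? (c ≟_) F
pick-avoids (c ∷ cs) F (d , here refl , d∉) | yes c∈ = ⊥-elim (d∉ c∈)
pick-avoids (c ∷ cs) F (d , there d∈ , d∉) | yes c∈ =
  let (p∈ , p∉) = pick-avoids cs F (d , d∈ , d∉) in there p∈ , p∉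
... | no c∉ = here refl , c∉

pick-spec : ∀ L F → AllPairs _≢_ L → length F < length L → pick L F ∈ L × pick L F ∉ F
pick-spec L F u shorter with all? (λ c → any? (c ≟_) F) L
... | yes L⊆F = ⊥-elim (<⇒≱ shorter (unique-⊆⇒length≤ u (All.lookup L⊆F)))
... | no ¬L⊆F = pick-avoids L F (find (¬All⇒Any¬ (λ c → any? (c ≟_) F) L ¬L⊆F))

record BlockSchedule (G : FinGraph) (k : ℕ) : Set where
  field
    blocks         : ℕ
    block offset   : V G → ℕ
    block<blocks   : ∀ x → block x < blocks
    slot-injective : ∀ x y → block x ≡ block y → offset x ≡ offset y → x ≡ y
    nbrs           : V G → List (V G)
    nbrs-complete  : ∀ x y → Adj G x y ⊎ Adj G y x → y ∈ nbrs x
    earlier-bound  : ∀ x → length (filter (λ y → block y <? block x) (nbrs x)) + offset x < k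

-- Colour the vertices in
-- lexicographic order of their slots, each avoiding the colours of its
-- neighbours in earlier blocks and of all earlier vertices of its own block:
-- fewer than k colours are forbidden, so one of its k colours is free.
module GreedyColouring (G : FinGraph) (k : ℕ)
  (enumerated : ∀ x → x ∈ verts G) (distinct : AllPairs _≢_ (verts G))
  (loopless : ∀ {x y} → Adj G x y → x ≢ y)
  (S : BlockSchedule G k)
  (L : V G → List ℕ) (isAssignment : IsKAssignment G k L) where

  open BlockSchedule S

  offset<k : ∀ x → offset x < k
  offset<k x = ≤-<-trans (m≤n+m (offset x) _) (earlier-bound x)

  rank : V G → ℕ
  rank x = block x * k + offset x

  rank-block : ∀ x y → block y < block x → rank y < rank x
  rank-block x y lt = begin-strict
      block y * k + offset y <⟨ +-monoʳ-< (block y * k) (offset<k y) ⟩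
      block y * k + k        ≡⟨ +-comm (block y * k) k ⟩
      suc (block y) * k      ≤⟨ *-monoˡ-≤ k lt ⟩
      block x * k            ≤⟨ m≤m+n _ _ ⟩
      rank x                 ∎
    where open ≤-Reasoning

  rank-offset : ∀ x y → block y ≡ block x → offset y < offset x → rank y < rank x
  rank-offset x y eq lt rewrite eq = +-monoʳ-< (block x * k) lt

  earlierNbrs : V G → List (V G)
  earlierNbrs x = filter (λ y → block y <? block x) (nbrs x)

  sameBlock? : (x y : V G) → Dec (block y ≡ block x × offset y < offset x)
  sameBlock? x y = (block y ≟ block x) ×-dec (offset y <? offset x)

  sameBlockBefore : V G → List (V G)
  sameBlockBefore x = filter (sameBlock? x) (verts G)

  -- The vertices whose colours x must avoid; all of them have smaller rank.
  forbidden : V G → List (V G)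
  forbidden x = earlierNbrs x ++ sameBlockBefore x

  forbidden-rank : ∀ x {y} → y ∈ forbidden x → rank y < rank x
  forbidden-rank x {y} y∈ with ∈-++⁻ (earlierNbrs x) y∈
  ... | inj₁ y∈N = rank-block x y (proj₂ (∈-filter⁻ (λ y → block y <? block x) {xs = nbrs x} y∈N))
  ... | inj₂ y∈B = let (eq , lt) = proj₂ (∈-filter⁻ (sameBlock? x) {xs = verts G} y∈B)
                   in rank-offset x y eq lt

  colourAcc : (x : V G) → Acc _<_ (rank x) → ℕ
  colourAcc x (acc rs) = pick (L x) (mapWith∈ (forbidden x) (λ {y} y∈ → colourAcc y (rs (forbidden-rank x y∈))))

  colourAcc-irrelevant : ∀ x (a b : Acc _<_ (rank x)) → colourAcc x a ≡ colourAcc x b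
  colourAcc-irrelevant x (acc rs) (acc rs′) = cong (pick (L x))
    (mapWith∈-cong (forbidden x) _ _ (λ {y} y∈ →
      colourAcc-irrelevant y (rs (forbidden-rank x y∈)) (rs′ (forbidden-rank x y∈))))

  colour : V G → ℕ
  colour x = colourAcc x (<-wellFounded (rank x))

  colourAcc-unfold : ∀ x (a : Acc _<_ (rank x)) → colourAcc x a ≡ pick (L x) (map colour (forbidden x))
  colourAcc-unfold x (acc rs) = cong (pick (L x))
    (trans (mapWith∈-cong (forbidden x) _ _ (λ {y} y∈ →
              colourAcc-irrelevant y (rs (forbidden-rank x y∈)) (<-wellFounded (rank y))))
           (mapWith∈≗map colour (forbidden x)))

  colour-unfold : ∀ x → colour x ≡ pick (L x) (map colour (forbidden x))
  colour-unfold x = colourAcc-unfold x (<-wellFounded (rank x))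

  -- Slots are injective, so the earlier vertices of x's block have distinct
  -- offsets below offset x.
  sameBlockBefore-length : ∀ x → length (sameBlockBefore x) ≤ offset x
  sameBlockBefore-length x = begin
      length (sameBlockBefore x)            ≡⟨ sym (length-map offset (sameBlockBefore x)) ⟩
      length (map offset (sameBlockBefore x)) ≤⟨ unique-below⇒length≤ (offset x) distinctOffsets below ⟩
      offset x                              ∎
    where
    open ≤-Reasoning
    distinctOffsets : AllPairs _≢_ (map offset (sameBlockBefore x))
    distinctOffsets = AP.map⁺ (AllPairs-strengthen
      (λ {a} {b} (ea , _) (eb , _) a≢b oa≡ob → a≢b (slot-injective a b (trans ea (sym eb)) oa≡ob))
      (all-filter (sameBlock? x) (verts G)) (AP.filter⁺ (sameBlock? x) distinct))
    below : ∀ {o} → o ∈ map offset (sameBlockBefore x) → o < offset x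
    below o∈ with ∈-map⁻ offset o∈
    ... | (y , y∈ , refl) = proj₂ (proj₂ (∈-filter⁻ (sameBlock? x) {xs = verts G} y∈))

  forbidden-length : ∀ x → length (map colour (forbidden x)) < length (L x)
  forbidden-length x = begin-strict
      length (map colour (forbidden x))                ≡⟨ length-map colour (forbidden x) ⟩
      length (forbidden x)                             ≡⟨ length-++ (earlierNbrs x) ⟩
      length (earlierNbrs x) + length (sameBlockBefore x) ≤⟨ +-monoʳ-≤ (length (earlierNbrs x)) (sameBlockBefore-length x) ⟩
      length (earlierNbrs x) + offset x                <⟨ earlier-bound x ⟩
      k                                                ≡⟨ sym (proj₁ (isAssignment x)) ⟩
      length (L x)                                     ∎
    where open ≤-Reasoning

  colour-spec : ∀ x → colour x ∈ L x × colour x ∉ map colour (forbidden x)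
  colour-spec x rewrite colour-unfold x =
    pick-spec (L x) (map colour (forbidden x)) (proj₂ (isAssignment x)) (forbidden-length x)

  colour-forbidden : ∀ x y → y ∈ forbidden x → colour x ≢ colour y
  colour-forbidden x y y∈ eq =
    proj₂ (colour-spec x) (subst (_∈ map colour (forbidden x)) (sym eq) (∈-map⁺ colour y∈))

  colour-sameBlock : ∀ x y → x ≢ y → block x ≡ block y → colour x ≢ colour y
  colour-sameBlock x y x≢y bx≡by with <-cmp (offset x) (offset y)
  ... | tri≈ _ ox≡oy _ = ⊥-elim (x≢y (slot-injective x y bx≡by ox≡oy))
  ... | tri< lt _ _ = λ eq → colour-forbidden y x
          (∈-++⁺ʳ (earlierNbrs y) (∈-filter⁺ (sameBlock? y) (enumerated x) (bx≡by , lt))) (sym eq)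
  ... | tri> _ _ gt = colour-forbidden x y
          (∈-++⁺ʳ (earlierNbrs x) (∈-filter⁺ (sameBlock? x) (enumerated y) (sym bx≡by , gt)))

  colour-proper : ∀ x y → Adj G x y → colour x ≢ colour y
  colour-proper x y xy with <-cmp (block x) (block y)
  ... | tri≈ _ eq _ = colour-sameBlock x y (loopless xy) eq
  ... | tri> _ _ gt = colour-forbidden x y
          (∈-++⁺ˡ (∈-filter⁺ (λ z → block z <? block x) (nbrs-complete x y (inj₁ xy)) gt))
  ... | tri< lt _ _ = λ eq → colour-forbidden y x
          (∈-++⁺ˡ (∈-filter⁺ (λ z → block z <? block y) (nbrs-complete y x (inj₂ xy)) lt)) (sym eq)

  -- The vertices of one colour lie in distinct blocks.
  colour-count : ∀ c → colourCount (verts G) colour c ≤ blocks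
  colour-count c = begin
      length ys             ≡⟨ sym (length-map block ys) ⟩
      length (map block ys) ≤⟨ unique-below⇒length≤ blocks distinctBlocks below ⟩
      blocks                ∎
    where
    open ≤-Reasoning
    ys : List (V G)
    ys = filter (λ v → colour v ≟ c) (verts G)
    distinctBlocks : AllPairs _≢_ (map block ys)
    distinctBlocks = AP.map⁺ (AllPairs-strengthen
      (λ {a} {b} ca cb a≢b ba≡bb → colour-sameBlock a b a≢b ba≡bb (trans ca (sym cb)))
      (all-filter (λ v → colour v ≟ c) (verts G)) (AP.filter⁺ (λ v → colour v ≟ c) distinct))
    below : ∀ {o} → o ∈ map block ys → o < blocks
    below o∈ with ∈-map⁻ block o∈
    ... | (y , _ , refl) = block<blocks y

schedule⇒equitablyChoosable : (G : FinGraph) (k : ℕ) →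
  (∀ x → x ∈ verts G) → AllPairs _≢_ (verts G) → (∀ {x y} → Adj G x y → x ≢ y) →
  (S : BlockSchedule G k) → BlockSchedule.blocks S ≤ ⌈ length (verts G) / k ⌉ →
  EquitablyChoosable G k
schedule⇒equitablyChoosable G k enumerated distinct loopless S few L isAssignment =
  colour , (λ v → proj₁ (colour-spec v)) , colour-proper , (λ c → ≤-trans (colour-count c) few)
  where open GreedyColouring G k enumerated distinct loopless S L isAssignment
-- Geometry of Θ(l₀,…,l_{m-1}) and of its square, for paths of length ≥ 2.
-- Every vertex is pathVertex i q for some path i and position q ≤ l i
-- (position 0 is u, position l i is w); two vertices are adjacent in the
-- square iff they are Near: at distance 1 or 2 along one path, or both second
-- vertices of paths (via u), or both second-to-last vertices (via w).  This
-- yields explicit neighbour lists nbrs x, which are all the counting needs.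
module ThetaGeometry (m : ℕ) (l : Fin m → ℕ) (l≥2 : ∀ i → 2 ≤ l i) where

  Vertex : Set
  Vertex = ThetaV m l

  G : FinGraph
  G = square (Theta m l)

  l≥1 : ∀ i → 1 ≤ l i
  l≥1 i = ≤-trans (s≤s z≤n) (l≥2 i)

  suc[l∸1] : ∀ i → suc (l i ∸ 1) ≡ l i
  suc[l∸1] i = trans (+-comm 1 (l i ∸ 1)) (m∸n+n≡m (l≥1 i))

  -- The vertex at distance q from u along path i (w for every q ≥ l i).
  pathVertex : Fin m → ℕ → Vertex
  pathVertex i zero = tu
  pathVertex i (suc t) with t <? (l i ∸ 1)
  ... | yes t<  = inner i (fromℕ< t<)
  ... | no  _   = tw

  pathVertex-inner : ∀ i j → pathVertex i (suc (toℕ j)) ≡ inner i j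
  pathVertex-inner i j with toℕ j <? (l i ∸ 1)
  ... | yes j< = cong (inner i) (fromℕ<-toℕ j j<)
  ... | no ¬j< = ⊥-elim (¬j< (toℕ<n j))

  pathVertex-end : ∀ i q → l i ≤ q → pathVertex i q ≡ tw
  pathVertex-end i zero l≤0 = ⊥-elim (<⇒≱ (l≥1 i) l≤0)
  pathVertex-end i (suc t) l≤ with t <? (l i ∸ 1)
  ... | yes t< = ⊥-elim (<⇒≱ (subst (suc t <_) (suc[l∸1] i) (s≤s t<)) l≤)
  ... | no  _  = refl

  pathVertex≡tu : ∀ i q → pathVertex i q ≡ tu → q ≡ 0
  pathVertex≡tu i zero    _ = refl
  pathVertex≡tu i (suc t) e with t <? (l i ∸ 1)
  pathVertex≡tu i (suc t) () | yes _
  pathVertex≡tu i (suc t) () | no _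

  pathVertex≡tw : ∀ i q → pathVertex i q ≡ tw → l i ≤ q
  pathVertex≡tw i zero ()
  pathVertex≡tw i (suc t) e with t <? (l i ∸ 1)
  pathVertex≡tw i (suc t) () | yes _
  ... | no ¬t< = subst (_≤ suc t) (suc[l∸1] i) (s≤s (≮⇒≥ ¬t<))

  pathVertex≡inner : ∀ i q i′ j′ → pathVertex i q ≡ inner i′ j′ → i ≡ i′ × q ≡ suc (toℕ j′)
  pathVertex≡inner i zero i′ j′ ()
  pathVertex≡inner i (suc t) i′ j′ e with t <? (l i ∸ 1)
  pathVertex≡inner i (suc t) i′ j′ e | no _ with e
  ... | ()
  pathVertex≡inner i (suc t) .i .(fromℕ< t<) refl | yes t< = refl , cong suc (sym (toℕ-fromℕ< t<))

  pathVertex-interior : ∀ i q → 1 ≤ q → q < l i →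
    Σ (Fin (l i ∸ 1)) λ j → pathVertex i q ≡ inner i j × suc (toℕ j) ≡ q
  pathVertex-interior i (suc t) _ q<l with t <? (l i ∸ 1)
  ... | yes t< = fromℕ< t< , refl , cong suc (toℕ-fromℕ< t<)
  ... | no ¬t< = ⊥-elim (¬t< (≤-pred (≤-trans q<l (≤-reflexive (sym (suc[l∸1] i))))))

  data Step : ℕ → ℕ → Set where
    up₁ : ∀ p → Step p (suc p)
    up₂ : ∀ p → Step p (suc (suc p))
    down₁ : ∀ q → Step (suc q) q
    down₂ : ∀ q → Step (suc (suc q)) q

  step-sym : ∀ {p q} → Step p q → Step q p
  step-sym (up₁ p) = down₁ p
  step-sym (up₂ p) = down₂ p
  step-sym (down₁ q) = up₁ q
  step-sym (down₂ q) = up₂ q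

  step-down : ∀ {p q} → Step p q → q ≤ p → q ≡ p ∸ 1 ⊎ q ≡ p ∸ 2
  step-down (up₁ p) q≤p = ⊥-elim (<⇒≱ ≤-refl q≤p)
  step-down (up₂ p) q≤p = ⊥-elim (<⇒≱ (n≤1+n _) q≤p)
  step-down (down₁ q) _   = inj₁ refl
  step-down (down₂ q) _   = inj₂ refl

  step-cases : ∀ {p q} → Step p q → q ≡ suc p ⊎ q ≡ suc (suc p) ⊎ suc q ≡ p ⊎ suc (suc q) ≡ p
  step-cases (up₁ p) = inj₁ refl
  step-cases (up₂ p) = inj₂ (inj₁ refl)
  step-cases (down₁ q) = inj₂ (inj₂ (inj₁ refl))
  step-cases (down₂ q) = inj₂ (inj₂ (inj₂ refl))

  data Near (x y : Vertex) : Set where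
    alongPath : (i : Fin m) (p q : ℕ) → x ≡ pathVertex i p → y ≡ pathVertex i q →
                p ≤ l i → q ≤ l i → Step p q → Near x y
    viaU      : (i i′ : Fin m) → x ≡ pathVertex i 1 → y ≡ pathVertex i′ 1 → Near x y
    viaW      : (i i′ : Fin m) → x ≡ pathVertex i (l i ∸ 1) → y ≡ pathVertex i′ (l i′ ∸ 1) → Near x y

  near-sym : ∀ {x y} → Near x y → Near y x
  near-sym (alongPath i p q ex ey lp lq s) = alongPath i q p ey ex lq lp (step-sym s)
  near-sym (viaU i i′ ex ey) = viaU i′ i ey ex
  near-sym (viaW i i′ ex ey) = viaW i′ i ey ex

  ThetaAdj : Vertex → Vertex → Set
  ThetaAdj x y = ThetaEdge m l x y ⊎ ThetaEdge m l y x

  -- An edge of Θ joins consecutive positions of one path (no path has length 1).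
  record AdjOnPath (x y : Vertex) : Set where
    constructor adjOnPath
    field
      path        : Fin m
      posX posY   : ℕ
      x≡          : x ≡ pathVertex path posX
      y≡          : y ≡ pathVertex path posY
      posX≤l      : posX ≤ l path
      posY≤l      : posY ≤ l path
      consecutive : posY ≡ suc posX ⊎ posX ≡ suc posY

  forwardStep : ∀ {x y} i p → x ≡ pathVertex i p → y ≡ pathVertex i (suc p) → suc p ≤ l i → AdjOnPath x y
  forwardStep i p ex ey p+1≤l = adjOnPath i p (suc p) ex ey (≤-trans (n≤1+n p) p+1≤l) p+1≤l (inj₁ refl)

  edge⇒onPath : ∀ {x y} → ThetaEdge m l x y → AdjOnPath x y
  edge⇒onPath (direct i l≡1) = ⊥-elim (<⇒≱ (l≥2 i) (≤-reflexive l≡1))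
  edge⇒onPath (first i j j≡0) = forwardStep i 0 refl
    (sym (trans (cong (λ z → pathVertex i (suc z)) (sym j≡0)) (pathVertex-inner i j))) (l≥1 i)
  edge⇒onPath (step i j j′ j+1≡j′) = forwardStep i (suc (toℕ j)) (sym (pathVertex-inner i j))
    (sym (trans (cong (pathVertex i ∘ suc) j+1≡j′) (pathVertex-inner i j′)))
    (subst (_≤ l i) (cong suc (sym j+1≡j′)) (subst (suc (toℕ j′) ≤_) (suc[l∸1] i) (s≤s (<⇒≤ (toℕ<n j′)))))
  edge⇒onPath (last i j j+1≡) = forwardStep i (suc (toℕ j)) (sym (pathVertex-inner i j))
    (sym (pathVertex-end i _ (≤-reflexive l≡))) (≤-reflexive (sym l≡))
    where
    l≡ : l i ≡ suc (suc (toℕ j))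
    l≡ = trans (sym (suc[l∸1] i)) (cong suc (sym j+1≡))

  adj⇒onPath : ∀ {x y} → ThetaAdj x y → AdjOnPath x y
  adj⇒onPath (inj₁ e) = edge⇒onPath e
  adj⇒onPath (inj₂ e) with edge⇒onPath e
  ... | adjOnPath i p q ey ex lp lq s = adjOnPath i q p ex ey lq lp (swap s)

  adj⇒near : ∀ {x y} → ThetaAdj x y → Near x y
  adj⇒near xy with adj⇒onPath xy
  ... | adjOnPath i p .(suc p) ex ey lp lq (inj₁ refl) = alongPath i p (suc p) ex ey lp lq (up₁ p)
  ... | adjOnPath i .(suc q) q ex ey lp lq (inj₂ refl) = alongPath i (suc q) q ex ey lp lq (down₁ q)

  meet⇒near : ∀ {x y} z → x ≢ y → AdjOnPath x z → AdjOnPath z y → Near x y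
  meet⇒near tu _ (adjOnPath i₁ p₁ q₁ ex ez₁ _ _ s₁) (adjOnPath i₂ p₂ q₂ ez₂ ey _ _ s₂)
    with pathVertex≡tu i₁ q₁ (sym ez₁) | pathVertex≡tu i₂ p₂ (sym ez₂)
  ... | refl | refl with s₁ | s₂
  ... | inj₁ () | _
  ... | inj₂ _ | inj₂ ()
  ... | inj₂ refl | inj₁ refl = viaU i₁ i₂ ex ey
  meet⇒near tw _ (adjOnPath i₁ p₁ q₁ ex ez₁ p₁≤ q₁≤ s₁) (adjOnPath i₂ p₂ q₂ ez₂ ey p₂≤ q₂≤ s₂) =
    viaW i₁ i₂ (trans ex (cong (pathVertex i₁) (beforeW s₁))) (trans ey (cong (pathVertex i₂) (afterW s₂)))
    where
    q₁≡l : q₁ ≡ l i₁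
    q₁≡l = ≤-antisym q₁≤ (pathVertex≡tw i₁ q₁ (sym ez₁))
    p₂≡l : p₂ ≡ l i₂
    p₂≡l = ≤-antisym p₂≤ (pathVertex≡tw i₂ p₂ (sym ez₂))
    beforeW : (q₁ ≡ suc p₁ ⊎ p₁ ≡ suc q₁) → p₁ ≡ l i₁ ∸ 1
    beforeW (inj₁ e) = trans (sym (cong (_∸ 1) e)) (cong (_∸ 1) q₁≡l)
    beforeW (inj₂ e) = ⊥-elim (<⇒≱ (subst (_< p₁) q₁≡l (≤-reflexive (sym e))) p₁≤)
    afterW : (q₂ ≡ suc p₂ ⊎ p₂ ≡ suc q₂) → q₂ ≡ l i₂ ∸ 1
    afterW (inj₂ e) = trans (sym (cong (_∸ 1) e)) (cong (_∸ 1) p₂≡l)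
    afterW (inj₁ e) = ⊥-elim (<⇒≱ (subst (_< q₂) p₂≡l (≤-reflexive (sym e))) q₂≤)
  meet⇒near (inner i j) x≢y (adjOnPath i₁ p₁ q₁ ex ez₁ p₁≤ _ s₁) (adjOnPath i₂ p₂ q₂ ez₂ ey _ q₂≤ s₂)
    with pathVertex≡inner i₁ q₁ i j (sym ez₁) | pathVertex≡inner i₂ p₂ i j (sym ez₂)
  ... | refl , eq₁ | refl , eq₂ with trans eq₁ (sym eq₂)
  ... | refl with s₁ | s₂
  ... | inj₁ refl | inj₁ refl = alongPath i₁ p₁ (suc (suc p₁)) ex ey p₁≤ q₂≤ (up₂ p₁)
  ... | inj₂ refl | inj₂ refl = alongPath i₁ (suc (suc q₂)) q₂ ex ey p₁≤ q₂≤ (down₂ q₂)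
  ... | inj₁ refl | inj₂ e = ⊥-elim (x≢y (trans ex (trans (cong (pathVertex i₁) (suc-injective e)) (sym ey))))
  ... | inj₂ refl | inj₁ refl = ⊥-elim (x≢y (trans ex (sym ey)))

  loopless : ∀ {x y} → Adj G x y → x ≢ y
  loopless = proj₁

  squareAdj⇒near : ∀ {x y} → Adj G x y → Near x y
  squareAdj⇒near (_ , inj₁ xy) = adj⇒near xy
  squareAdj⇒near (x≢y , inj₂ (z , xz , zy)) = meet⇒near z x≢y (adj⇒onPath xz) (adj⇒onPath zy)

  when : ∀ {P : Set} → Dec P → List Vertex → List Vertex
  when (yes _) xs = xs
  when (no _)  xs = []

  ∈-when : ∀ {P : Set} (d : Dec P) → P → ∀ {y xs} → y ∈ xs → y ∈ when d xs
  ∈-when (yes _) _ y∈ = y∈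
  ∈-when (no ¬p) p _  = ⊥-elim (¬p p)

  firstInners : List Vertex
  firstInners = map (λ i → pathVertex i 1) (allFin m)

  lastInners : List Vertex
  lastInners = map (λ i → pathVertex i (l i ∸ 1)) (allFin m)

  pathNbrs : Fin m → ℕ → List Vertex
  pathNbrs i p = pathVertex i (p ∸ 1) ∷ pathVertex i (suc p) ∷
    (when (2 ≤? p) (pathVertex i (p ∸ 2) ∷ []) ++ when (suc p <? l i) (pathVertex i (suc (suc p)) ∷ []))

  innerNbrs : Fin m → ℕ → List Vertex
  innerNbrs i p = pathNbrs i p ++ (when (p ≟ 1) firstInners ++ when (suc p ≟ l i) lastInners)

  nbrs : Vertex → List Vertex
  nbrs tu          = concat (map (λ i → pathVertex i 1 ∷ pathVertex i 2 ∷ []) (allFin m))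
  nbrs tw          = concat (map (λ i → pathVertex i (l i ∸ 1) ∷ pathVertex i (l i ∸ 2) ∷ []) (allFin m))
  nbrs (inner i j) = innerNbrs i (suc (toℕ j))

  near-tu : ∀ y → Near tu y → y ∈ nbrs tu
  near-tu y (alongPath i p q ex ey lp lq s) with pathVertex≡tu i p (sym ex)
  near-tu y (alongPath i .0 .1 ex refl lp lq (up₁ .0)) | refl = ∈-concat-map-allFin _ i (here refl)
  near-tu y (alongPath i .0 .2 ex refl lp lq (up₂ .0)) | refl = ∈-concat-map-allFin _ i (there (here refl))
  near-tu y (viaU i i′ ex ey) with pathVertex≡tu i 1 (sym ex)
  ... | ()
  near-tu y (viaW i i′ ex ey) = ⊥-elim (<⇒≱ (l≥2 i)
    (≤-reflexive (trans (sym (suc[l∸1] i)) (cong suc (pathVertex≡tu i _ (sym ex))))))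

  near-tw : ∀ y → Near tw y → y ∈ nbrs tw
  near-tw y (alongPath i p q ex refl lp lq s) with step-down s (subst (q ≤_) (sym p≡l) lq)
    where
    p≡l : p ≡ l i
    p≡l = ≤-antisym lp (pathVertex≡tw i p (sym ex))
  ... | inj₁ e = ∈-concat-map-allFin _ i (here (cong (pathVertex i) (trans e (cong (_∸ 1) p≡l))))
    where
    p≡l : p ≡ l i
    p≡l = ≤-antisym lp (pathVertex≡tw i p (sym ex))
  ... | inj₂ e = ∈-concat-map-allFin _ i (there (here (cong (pathVertex i) (trans e (cong (_∸ 2) p≡l)))))
    where
    p≡l : p ≡ l i
    p≡l = ≤-antisym lp (pathVertex≡tw i p (sym ex))
  near-tw y (viaU i i′ ex ey) = ⊥-elim (<⇒≱ (l≥2 i) (pathVertex≡tw i 1 (sym ex)))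
  near-tw y (viaW i i′ ex ey) = ⊥-elim (<⇒≱ (≤-reflexive (suc[l∸1] i)) (pathVertex≡tw i _ (sym ex)))

  near-inner : ∀ i j y → Near (inner i j) y → y ∈ nbrs (inner i j)
  near-inner i j y (alongPath i′ p q ex refl lp lq s) with pathVertex≡inner i′ p i j (sym ex)
  ... | refl , refl with step-cases s
  ... | inj₁ e = ∈-++⁺ˡ {xs = pathNbrs i p} (there (here (cong (pathVertex i) e)))
  ... | inj₂ (inj₁ e) = ∈-++⁺ˡ {xs = pathNbrs i p} (there (there (∈-++⁺ʳ (when (2 ≤? p) _)
          (∈-when (suc p <? l i) (subst (_≤ l i) e lq) (here (cong (pathVertex i) e))))))
  ... | inj₂ (inj₂ (inj₁ e)) = ∈-++⁺ˡ {xs = pathNbrs i p} (here (cong (pathVertex i) (cong (_∸ 1) e)))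
  ... | inj₂ (inj₂ (inj₂ e)) = ∈-++⁺ˡ {xs = pathNbrs i p} (there (there (∈-++⁺ˡ
          (∈-when (2 ≤? p) (subst (2 ≤_) e (s≤s (s≤s z≤n))) (here (cong (pathVertex i) (cong (_∸ 2) e)))))))
  near-inner i j y (viaU i′ i″ ex refl) with pathVertex≡inner i′ 1 i j (sym ex)
  ... | refl , e = ∈-++⁺ʳ (pathNbrs i _) (∈-++⁺ˡ
        (∈-when (suc (toℕ j) ≟ 1) (sym e) (∈-map⁺ (λ i → pathVertex i 1) (∈-allFin i″))))
  near-inner i j y (viaW i′ i″ ex refl) with pathVertex≡inner i′ (l i′ ∸ 1) i j (sym ex)
  ... | refl , e = ∈-++⁺ʳ (pathNbrs i _) (∈-++⁺ʳ (when (suc (toℕ j) ≟ 1) firstInners)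
        (∈-when (suc (suc (toℕ j)) ≟ l i) (trans (cong suc (sym e)) (suc[l∸1] i))
          (∈-map⁺ (λ i → pathVertex i (l i ∸ 1)) (∈-allFin i″))))

  near⇒∈nbrs : ∀ x y → Near x y → y ∈ nbrs x
  near⇒∈nbrs tu          = near-tu
  near⇒∈nbrs tw          = near-tw
  near⇒∈nbrs (inner i j) = near-inner i j

  nbrs-complete : ∀ x y → Adj G x y ⊎ Adj G y x → y ∈ nbrs x
  nbrs-complete x y (inj₁ xy) = near⇒∈nbrs x y (squareAdj⇒near xy)
  nbrs-complete x y (inj₂ yx) = near⇒∈nbrs x y (near-sym (squareAdj⇒near yx))

  row : Fin m → List Vertex
  row i = map (inner i) (allFin (l i ∸ 1))

  inners : List Vertex
  inners = concat (map row (allFin m))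

  enumerated : ∀ x → x ∈ verts G
  enumerated tu          = here refl
  enumerated tw          = there (here refl)
  enumerated (inner i j) = there (there (∈-concat-map-allFin _ i (∈-map⁺ (inner i) (∈-allFin j))))

  ∈inners⇒inner : ∀ {y} → y ∈ inners → Σ (Fin m) λ i → Σ (Fin (l i ∸ 1)) λ j → y ≡ inner i j
  ∈inners⇒inner y∈ with ∈-concat⁻′ (map row (allFin m)) y∈
  ... | (xs , y∈xs , xs∈) with ∈-map⁻ row xs∈
  ... | (i , _ , refl) with ∈-map⁻ (inner i) y∈xs
  ... | (j , _ , y≡) = i , j , y≡

  inner-injective₁ : ∀ {i i′ j j′} → inner {m} {l} i j ≡ inner i′ j′ → i ≡ i′
  inner-injective₁ refl = refl

  inner-injective₂ : ∀ {i j j′} → inner {m} {l} i j ≡ inner i j′ → j ≡ j′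
  inner-injective₂ refl = refl

  distinct-inners : AllPairs _≢_ inners
  distinct-inners = AP.concat⁺ (All.tabulate rowDistinct) (AP.map⁺ (AP.tabulate⁺ rowsDisjoint))
    where
    rowDistinct : ∀ {xs} → xs ∈ map row (allFin m) → AllPairs _≢_ xs
    rowDistinct xs∈ with ∈-map⁻ row xs∈
    ... | (i , _ , refl) = AP.map⁺ (AP.tabulate⁺ (λ j≢j′ e → j≢j′ (inner-injective₂ e)))
    rowsDisjoint : ∀ {i i′ : Fin m} → i ≢ i′ → All (λ x → All (x ≢_) (row i′)) (row i)
    rowsDisjoint {i} {i′} i≢i′ = All.tabulate (λ x∈ → All.tabulate (λ y∈ x≡y → clash x∈ y∈ x≡y))
      where
      clash : ∀ {x y} → x ∈ row i → y ∈ row i′ → x ≡ y → ⊥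
      clash x∈ y∈ x≡y with ∈-map⁻ (inner i) x∈ | ∈-map⁻ (inner i′) y∈
      ... | (_ , _ , refl) | (_ , _ , refl) = i≢i′ (inner-injective₁ x≡y)

  distinct : AllPairs _≢_ (verts G)
  distinct = All.tabulate tu≢ ∷ All.tabulate tw≢ ∷ distinct-inners
    where
    tu≢ : ∀ {y} → y ∈ tw ∷ inners → tu ≢ y
    tu≢ (here refl) ()
    tu≢ (there y∈) tu≡y with ∈inners⇒inner y∈
    ... | (_ , _ , refl) with tu≡y
    ... | ()
    tw≢ : ∀ {y} → y ∈ inners → tw ≢ y
    tw≢ y∈ tw≡y with ∈inners⇒inner y∈
    ... | (_ , _ , refl) with tw≡y
    ... | ()

  order : ℕ
  order = length (verts G)

  order-eq : order ≡ 2 + sumFin (λ i → l i ∸ 1)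
  order-eq = cong (2 +_) (trans (length-concat-map-allFin row)
    (sumFin-cong (λ i → trans (length-map (inner {m} {l} i) (allFin (l i ∸ 1))) (length-tabulate {n = l i ∸ 1} id))))

  -- Counting the neighbours of a vertex that satisfy a decidable property P
  -- (in the application: lying in an earlier block), one group at a time.
  module Tally {P : Vertex → Set} (P? : ∀ y → Dec (P y)) where

    tally : List Vertex → ℕ
    tally = count P?

    tally-single : ∀ y → tally (y ∷ []) ≤ 1
    tally-single y = count≤length P? (y ∷ [])

    tally-reject : ∀ y → ¬ P y → tally (y ∷ []) ≤ 0
    tally-reject y ¬py = ≤-reflexive (count-reject P? y [] ¬py)

    tally-when : ∀ {R : Set} (d : Dec R) xs r → (R → tally xs ≤ r) → tally (when d xs) ≤ r
    tally-when (yes r) xs _ bound = bound r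
    tally-when (no _)  xs _ _     = z≤n

    tally-pathNbrs : ∀ i p b₋₁ b₊₁ b₋₂ b₊₂ →
      tally (pathVertex i (p ∸ 1) ∷ []) ≤ b₋₁ → tally (pathVertex i (suc p) ∷ []) ≤ b₊₁ →
      (2 ≤ p → tally (pathVertex i (p ∸ 2) ∷ []) ≤ b₋₂) →
      (suc p < l i → tally (pathVertex i (suc (suc p)) ∷ []) ≤ b₊₂) →
      tally (pathNbrs i p) ≤ b₋₁ + b₊₁ + b₋₂ + b₊₂
    tally-pathNbrs i p b₋₁ b₊₁ b₋₂ b₊₂ h₋₁ h₊₁ h₋₂ h₊₂ = begin
        tally (pathNbrs i p)
          ≡⟨ count-++ P? [ x₋₁ ] _ ⟩
        tally [ x₋₁ ] + tally (x₊₁ ∷ (o₋₂ ++ o₊₂))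
          ≡⟨ cong (tally [ x₋₁ ] +_) (count-++ P? [ x₊₁ ] (o₋₂ ++ o₊₂)) ⟩
        tally [ x₋₁ ] + (tally [ x₊₁ ] + tally (o₋₂ ++ o₊₂))
          ≡⟨ cong (λ z → tally [ x₋₁ ] + (tally [ x₊₁ ] + z)) (count-++ P? o₋₂ o₊₂) ⟩
        tally [ x₋₁ ] + (tally [ x₊₁ ] + (tally o₋₂ + tally o₊₂))
          ≤⟨ +-mono-≤ h₋₁ (+-mono-≤ h₊₁ (+-mono-≤ (tally-when (2 ≤? p) _ b₋₂ h₋₂) (tally-when (suc p <? l i) _ b₊₂ h₊₂))) ⟩
        b₋₁ + (b₊₁ + (b₋₂ + b₊₂))
          ≡⟨ sym (trans (+-assoc (b₋₁ + b₊₁) b₋₂ b₊₂) (+-assoc b₋₁ b₊₁ (b₋₂ + b₊₂))) ⟩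
        b₋₁ + b₊₁ + b₋₂ + b₊₂ ∎
      where
      open ≤-Reasoning
      x₋₁ x₊₁ : Vertex
      x₋₁ = pathVertex i (p ∸ 1)
      x₊₁ = pathVertex i (suc p)
      o₋₂ o₊₂ : List Vertex
      o₋₂ = when (2 ≤? p) (pathVertex i (p ∸ 2) ∷ [])
      o₊₂ = when (suc p <? l i) (pathVertex i (suc (suc p)) ∷ [])

    tally-innerNbrs : ∀ i p bp bf bl → tally (pathNbrs i p) ≤ bp →
      (p ≡ 1 → tally firstInners ≤ bf) → (suc p ≡ l i → tally lastInners ≤ bl) →
      tally (innerNbrs i p) ≤ bp + (bf + bl)
    tally-innerNbrs i p bp bf bl hp hf hl = begin
        tally (innerNbrs i p)
          ≡⟨ count-++ P? (pathNbrs i p) _ ⟩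
        tally (pathNbrs i p) + tally (when (p ≟ 1) firstInners ++ when (suc p ≟ l i) lastInners)
          ≡⟨ cong (tally (pathNbrs i p) +_) (count-++ P? (when (p ≟ 1) firstInners) _) ⟩
        tally (pathNbrs i p) + (tally (when (p ≟ 1) firstInners) + tally (when (suc p ≟ l i) lastInners))
          ≤⟨ +-mono-≤ hp (+-mono-≤ (tally-when (p ≟ 1) _ bf hf) (tally-when (suc p ≟ l i) _ bl hl)) ⟩
        bp + (bf + bl) ∎
      where open ≤-Reasoning

    tally-firstInners-none : (∀ i → ¬ P (pathVertex i 1)) → tally firstInners ≤ 0
    tally-firstInners-none none = ≤-reflexive (count-none P? firstInners reject)
      where
      reject : ∀ {y} → y ∈ firstInners → ¬ P y
      reject y∈ with ∈-map⁻ (λ i → pathVertex i 1) y∈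
      ... | (i , _ , refl) = none i

    tally-lastInners-none : (∀ i → ¬ P (pathVertex i (l i ∸ 1))) → tally lastInners ≤ 0
    tally-lastInners-none none = ≤-reflexive (count-none P? lastInners reject)
      where
      reject : ∀ {y} → y ∈ lastInners → ¬ P y
      reject y∈ with ∈-map⁻ (λ i → pathVertex i (l i ∸ 1)) y∈
      ... | (i , _ , refl) = none i

    tally-lastInners≤m : tally lastInners ≤ m
    tally-lastInners≤m = begin
        tally lastInners  ≤⟨ count≤length P? lastInners ⟩
        length lastInners ≡⟨ length-map (λ i → pathVertex i (l i ∸ 1)) (allFin m) ⟩
        length (allFin m) ≡⟨ length-tabulate {n = m} id ⟩
        m                 ∎
      where open ≤-Reasoning
-- When n ≤ k a single block suffices: the offset of a vertex is its position
-- in the vertex list.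
module SmallTheta (m : ℕ) (l : Fin m → ℕ) (l≥2 : ∀ i → 2 ≤ l i) where
  open ThetaGeometry m l l≥2

  innerCount : Fin m → ℕ
  innerCount i = l i ∸ 1

  index : Vertex → ℕ
  index tu          = 0
  index tw          = 1
  index (inner i j) = 2 + (prefixSum innerCount i + toℕ j)

  index<order : ∀ x → index x < order
  index<order tu          = ≤-trans (s≤s z≤n) (≤-reflexive (sym order-eq))
  index<order tw          = ≤-trans (s≤s (s≤s z≤n)) (≤-reflexive (sym order-eq))
  index<order (inner i j) = ≤-trans (s≤s (s≤s (<-≤-trans (+-monoʳ-< (prefixSum innerCount i) (toℕ<n j))
    (prefixSum+term≤sum innerCount i)))) (≤-reflexive (sym order-eq))

  index-injective : ∀ x y → index x ≡ index y → x ≡ y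
  index-injective tu tu _ = refl
  index-injective tw tw _ = refl
  index-injective (inner i j) (inner i′ j′) eq
    with prefixSum-injective innerCount i i′ (toℕ j) (toℕ j′) (toℕ<n j) (toℕ<n j′) (suc-injective (suc-injective eq))
  ... | refl , j≡j′ = cong (inner i) (toℕ-injective j≡j′)
  index-injective tu tw ()
  index-injective tu (inner i j) ()
  index-injective tw tu ()
  index-injective tw (inner i j) ()
  index-injective (inner i j) tu ()
  index-injective (inner i j) tw ()

  smallSchedule : (k : ℕ) → order ≤ k → BlockSchedule G k
  smallSchedule k n≤k = record
    { blocks = 1 ; block = λ _ → 0 ; offset = index ; block<blocks = λ _ → s≤s z≤n
    ; slot-injective = λ x y _ → index-injective x y ; nbrs = nbrs ; nbrs-complete = nbrs-complete
    ; earlier-bound = λ x → subst (λ ys → length ys + index x < k)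
        (sym (filter-none (λ y → 0 <? 0) (All.universal (λ _ ()) (nbrs x)))) (<-≤-trans (index<order x) n≤k) }

-- The block schedule for k < n, where n is the order of Θ and k ≥ m + 3.
-- There are Q = ⌈ n / k ⌉ blocks.  The top block Q ∸ 1 holds u and the first
-- headLen i inner vertices of every path; the second block Q ∸ 2 holds w and
-- the last tailLen i inner vertices of every path.  The remaining "free"
-- vertices are numbered consecutively, path after path from u towards w, by
-- freeIndex.  The first th₁ of them also go into the top block and the last
-- secondFree into the second block, as long as there is room; the midCount
-- free vertices in between get consecutive ranks midBase, midBase + 1, …
-- filling the last midCount slots below block Q ∸ 2 (rank r lies in block
-- r / k at offset r % k).  Offsets inside the top and second blocks are
-- chosen by hand so that every vertex has few enough neighbours in earlier
-- blocks; the hypotheses l₀ ≥ 2 and l₁ ≥ 4 (and monotonicity) are what make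
-- this hand-made part fit into k ≥ m + 3 offsets.
module Scheme (m′ : ℕ) (l : Fin (suc (suc (suc m′))) → ℕ)
  (mono : ∀ i j → toℕ i ≤ toℕ j → l i ≤ l j)
  (l₀≥2 : 2 ≤ l zero) (l₁≥4 : 4 ≤ l (suc zero))
  (k1 : ℕ) (k≥m+3 : 6 + m′ ≤ suc k1)
  where

  m : ℕ
  m = suc (suc (suc m′))

  k : ℕ
  k = suc k1

  i0 i1 i2 : Fin m
  i0 = zero
  i1 = suc zero
  i2 = suc (suc zero)

  l≥2 : ∀ i → 2 ≤ l i
  l≥2 i = ≤-trans l₀≥2 (mono zero i z≤n)

  l≥4 : ∀ i → 1 ≤ toℕ i → 4 ≤ l i
  l≥4 zero ()
  l≥4 (suc i) _ = ≤-trans l₁≥4 (mono (suc zero) (suc i) (s≤s z≤n))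

  open ThetaGeometry m l l≥2 public
  open +-*-Solver using (solve; _:+_; _:*_; _:=_; con)

  ind≥3 : ℕ → ℕ
  ind≥3 (suc (suc (suc _))) = 1
  ind≥3 _ = 0

  ind≥5 : ℕ → ℕ
  ind≥5 (suc (suc (suc (suc (suc _))))) = 1
  ind≥5 _ = 0

  δ₀ δ₁ δ₂ : ℕ
  δ₀ = ind≥3 (l i0)
  δ₁ = ind≥5 (l i1)
  δ₂ = ind≥5 (l i2)

  -- Positions 1 … headLen i of path i are in the top block, the last
  -- tailLen i inner positions in the second block, the freeLen i others free.
  headLen : Fin m → ℕ
  headLen zero          = 1
  headLen (suc zero)    = 3
  headLen (suc (suc _)) = 1

  tailLen : Fin m → ℕ
  tailLen zero                = δ₀
  tailLen (suc zero)          = δ₁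
  tailLen (suc (suc zero))    = 2 + δ₂
  tailLen (suc (suc (suc _))) = 1

  freeLen : Fin m → ℕ
  freeLen i = l i ∸ 1 ∸ headLen i ∸ tailLen i

  freeTotal : ℕ
  freeTotal = sumFin freeLen

  -- First offset of the second block not used by w and the tails.
  secondBase : ℕ
  secondBase = suc m′ + δ₀ + δ₁ + δ₂

  -- topRoom and secondRoom are the offsets left for free vertices in the top
  -- and second blocks; th₁ ≤ th₂ split the free indices into the three kinds.
  topRoom secondRoom th₁ rest₁ secondFree midCount th₂ : ℕ
  topRoom    = k ∸ (6 + m′)
  secondRoom = k ∸ (secondBase + 2)
  th₁        = topRoom ⊓ freeTotal
  rest₁      = freeTotal ∸ th₁
  secondFree = secondRoom ⊓ rest₁
  midCount   = rest₁ ∸ secondFree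
  th₂        = th₁ + midCount

  Q : ℕ
  Q = ⌈ order / k ⌉

  midBase : ℕ
  midBase = (Q ∸ 2) * k ∸ midCount

  -- A slot is an offset in the top block, an offset in the second block, or
  -- a rank (block r / k, offset r % k).
  data Slot : Set where
    top second ranked : ℕ → Slot

  freeSlot : ℕ → Slot
  freeSlot c with c <? th₁
  ... | yes _ = top (4 + m′ + c)
  ... | no _ with c <? th₂
  ... | yes _ = ranked (midBase + (c ∸ th₁))
  ... | no _  = second (secondBase + (c ∸ th₂))

  headOffset : Fin m → ℕ → ℕ
  headOffset zero          _ = 2
  headOffset (suc zero)    1 = k1
  headOffset (suc zero)    2 = k1 ∸ 1
  headOffset (suc zero)    _ = 0
  headOffset (suc (suc i)) _ = 3 + toℕ i

  tailOffset : Fin m → ℕ → ℕ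
  tailOffset zero                _ = suc m′
  tailOffset (suc zero)          _ = suc m′ + δ₀
  tailOffset (suc (suc zero))    p with suc p ≟ l i2
  ... | yes _ = k1
  ... | no _ with suc (suc p) ≟ l i2
  ... | yes _ = k1 ∸ 1
  ... | no _  = suc m′ + δ₀ + δ₁
  tailOffset (suc (suc (suc i))) _ = suc (toℕ i)

  freeIndex : Fin m → ℕ → ℕ
  freeIndex i p = prefixSum freeLen i + (p ∸ headLen i ∸ 1)

  pathSlot : Fin m → ℕ → Slot
  pathSlot i p with p ≤? headLen i
  ... | yes _ = top (headOffset i p)
  ... | no _ with l i ≤? p + tailLen i
  ... | yes _ = second (tailOffset i p)
  ... | no _  = freeSlot (freeIndex i p)

  slot : Vertex → Slot
  slot tu          = top 1
  slot tw          = second 0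
  slot (inner i j) = pathSlot i (suc (toℕ j))

  slotBlock : Slot → ℕ
  slotBlock (top _)    = Q ∸ 1
  slotBlock (second _) = Q ∸ 2
  slotBlock (ranked r) = r / k

  slotOffset : Slot → ℕ
  slotOffset (top o)    = o
  slotOffset (second o) = o
  slotOffset (ranked r) = r % k

  blockOf offsetOf : Vertex → ℕ
  blockOf x  = slotBlock (slot x)
  offsetOf x = slotOffset (slot x)

  ind≥3≤1 : ∀ L → ind≥3 L ≤ 1
  ind≥3≤1 (suc (suc (suc _))) = s≤s z≤n
  ind≥3≤1 0 = z≤n
  ind≥3≤1 1 = z≤n
  ind≥3≤1 2 = z≤n

  ind≥5≤1 : ∀ L → ind≥5 L ≤ 1
  ind≥5≤1 (suc (suc (suc (suc (suc _))))) = s≤s z≤n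
  ind≥5≤1 0 = z≤n
  ind≥5≤1 1 = z≤n
  ind≥5≤1 2 = z≤n
  ind≥5≤1 3 = z≤n
  ind≥5≤1 4 = z≤n

  head+tail≤₀ : ∀ L → 2 ≤ L → 1 + ind≥3 L ≤ L ∸ 1
  head+tail≤₀ (suc zero) (s≤s ())
  head+tail≤₀ (suc (suc zero)) _ = s≤s z≤n
  head+tail≤₀ (suc (suc (suc L))) _ = s≤s (s≤s z≤n)

  head+tail≤₁ : ∀ L → 4 ≤ L → 3 + ind≥5 L ≤ L ∸ 1
  head+tail≤₁ (suc (suc (suc (suc zero)))) _ = s≤s (s≤s (s≤s z≤n))
  head+tail≤₁ (suc (suc (suc (suc (suc L))))) _ = s≤s (s≤s (s≤s (s≤s z≤n)))
  head+tail≤₁ (suc zero) (s≤s ())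
  head+tail≤₁ (suc (suc zero)) (s≤s (s≤s ()))
  head+tail≤₁ (suc (suc (suc zero))) (s≤s (s≤s (s≤s ())))

  head+tail≤₃ : ∀ L → 4 ≤ L → 2 ≤ L ∸ 1
  head+tail≤₃ (suc (suc (suc (suc L)))) _ = s≤s (s≤s z≤n)
  head+tail≤₃ (suc zero) (s≤s ())
  head+tail≤₃ (suc (suc zero)) (s≤s (s≤s ()))
  head+tail≤₃ (suc (suc (suc zero))) (s≤s (s≤s (s≤s ())))

  head+tail≤ : ∀ i → headLen i + tailLen i ≤ l i ∸ 1
  head+tail≤ zero                = head+tail≤₀ (l zero) l₀≥2
  head+tail≤ (suc zero)          = head+tail≤₁ (l (suc zero)) l₁≥4
  head+tail≤ (suc (suc zero))    = head+tail≤₁ (l i2) (l≥4 i2 (s≤s z≤n))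
  head+tail≤ (suc (suc (suc i))) = head+tail≤₃ (l (suc (suc (suc i)))) (l≥4 (suc (suc (suc i))) (s≤s z≤n))

  head+tail+free : ∀ i → headLen i + tailLen i + freeLen i ≡ l i ∸ 1
  head+tail+free i = begin
      headLen i + tailLen i + (l i ∸ 1 ∸ headLen i ∸ tailLen i)
        ≡⟨ cong (headLen i + tailLen i +_) (∸-+-assoc (l i ∸ 1) (headLen i) (tailLen i)) ⟩
      headLen i + tailLen i + (l i ∸ 1 ∸ (headLen i + tailLen i))
        ≡⟨ m+[n∸m]≡n (head+tail≤ i) ⟩
      l i ∸ 1 ∎
    where open ≡-Reasoning

  headLen<l : ∀ i → headLen i < l i
  headLen<l i = ≤-trans (s≤s (≤-trans (m≤m+n (headLen i) (tailLen i)) (head+tail≤ i))) (≤-reflexive (suc[l∸1] i))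

  hasSuccessor₀ : ∀ L p → 1 < p → p + ind≥3 L < L → suc p < L
  hasSuccessor₀ (suc (suc (suc L))) p _ lt = subst (_< suc (suc (suc L))) (+-comm p 1) lt
  hasSuccessor₀ zero p _ ()
  hasSuccessor₀ (suc zero) p tp lt = ⊥-elim (<⇒≱ lt (≤-trans (≤-trans (n≤1+n 1) tp) (m≤m+n p _)))
  hasSuccessor₀ (suc (suc zero)) p tp lt = ⊥-elim (<⇒≱ lt (≤-trans tp (m≤m+n p _)))

  hasSuccessor₁ : ∀ L p → 3 < p → p + ind≥5 L < L → suc p < L
  hasSuccessor₁ (suc (suc (suc (suc (suc L))))) p _ lt = subst (_< suc (suc (suc (suc (suc L))))) (+-comm p 1) lt
  hasSuccessor₁ zero p _ ()
  hasSuccessor₁ (suc zero) p tp lt = ⊥-elim (<⇒≱ lt (≤-trans (≤-trans (s≤s z≤n) tp) (m≤m+n p _)))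
  hasSuccessor₁ (suc (suc zero)) p tp lt = ⊥-elim (<⇒≱ lt (≤-trans (≤-trans (s≤s (s≤s z≤n)) tp) (m≤m+n p _)))
  hasSuccessor₁ (suc (suc (suc zero))) p tp lt = ⊥-elim (<⇒≱ lt (≤-trans (≤-trans (s≤s (s≤s (s≤s z≤n))) tp) (m≤m+n p _)))
  hasSuccessor₁ (suc (suc (suc (suc zero)))) p tp lt = ⊥-elim (<⇒≱ lt (≤-trans tp (m≤m+n p _)))

  hasSuccessor : ∀ L p s → 1 ≤ s → p + s < L → suc p < L
  hasSuccessor L p s s≥1 lt = ≤-trans (s≤s (≤-trans (≤-reflexive (+-comm 1 p)) (+-monoʳ-≤ p s≥1))) lt

  free⇒hasSuccessor : ∀ i p → headLen i < p → p + tailLen i < l i → suc p < l i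
  free⇒hasSuccessor zero                p tp lt = hasSuccessor₀ (l zero) p tp lt
  free⇒hasSuccessor (suc zero)          p tp lt = hasSuccessor₁ (l (suc zero)) p tp lt
  free⇒hasSuccessor (suc (suc zero))    p tp lt = hasSuccessor (l i2) p _ (s≤s z≤n) lt
  free⇒hasSuccessor (suc (suc (suc i))) p tp lt = hasSuccessor (l (suc (suc (suc i)))) p 1 ≤-refl lt

  pathSlot-head : ∀ i q → q ≤ headLen i → pathSlot i q ≡ top (headOffset i q)
  pathSlot-head i q h with q ≤? headLen i
  ... | yes _ = refl
  ... | no nh = ⊥-elim (nh h)

  pathSlot-tail : ∀ i q → headLen i < q → l i ≤ q + tailLen i → pathSlot i q ≡ second (tailOffset i q)
  pathSlot-tail i q h1 h2 with q ≤? headLen i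
  ... | yes y = ⊥-elim (<⇒≱ h1 y)
  ... | no _ with l i ≤? q + tailLen i
  ... | yes _ = refl
  ... | no n2 = ⊥-elim (n2 h2)

  pathSlot-free : ∀ i q → headLen i < q → q + tailLen i < l i → pathSlot i q ≡ freeSlot (freeIndex i q)
  pathSlot-free i q h1 h2 with q ≤? headLen i
  ... | yes y = ⊥-elim (<⇒≱ h1 y)
  ... | no _ with l i ≤? q + tailLen i
  ... | yes y = ⊥-elim (<⇒≱ h2 y)
  ... | no _ = refl

  slot-pathVertex : ∀ i q → 1 ≤ q → q < l i → slot (pathVertex i q) ≡ pathSlot i q
  slot-pathVertex i q h1 h2 with pathVertex-interior i q h1 h2
  ... | (j , e , e') rewrite e = cong (pathSlot i) e'

  InTop InSecond : Vertex → Set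
  InTop y = Σ ℕ λ o → slot y ≡ top o
  InSecond y = Σ ℕ λ o → slot y ≡ second o

  head⇒top : ∀ i q → q ≤ headLen i → InTop (pathVertex i q)
  head⇒top i zero h = 1 , refl
  head⇒top i (suc q) h = headOffset i (suc q) , trans
      (slot-pathVertex i (suc q) (s≤s z≤n) (<-≤-trans (s≤s h) (headLen<l i))) (pathSlot-head i (suc q) h)

  tail⇒second : ∀ i q → headLen i < q → l i ≤ q + tailLen i → InSecond (pathVertex i q)
  tail⇒second i q h1 h2 with l i ≤? q
  ... | yes y = 0 , cong slot (pathVertex-end i q y)
  ... | no ny = tailOffset i q , trans (slot-pathVertex i q (≤-trans (s≤s z≤n) h1) (≰⇒> ny)) (pathSlot-tail i q h1 h2)

  slot-free : ∀ i q → headLen i < q → q + tailLen i < l i → slot (pathVertex i q) ≡ freeSlot (freeIndex i q)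
  slot-free i q h1 h2 = trans (slot-pathVertex i q (≤-trans (s≤s z≤n) h1) (≤-trans (s≤s (m≤m+n q (tailLen i))) h2)) (pathSlot-free i q h1 h2)

  freeIndex-suc : ∀ i q → headLen i < q → freeIndex i (suc q) ≡ suc (freeIndex i q)
  freeIndex-suc i q h = trans (cong (prefixSum freeLen i +_) e) (+-suc (prefixSum freeLen i) _)
    where
    e : suc q ∸ headLen i ∸ 1 ≡ suc (q ∸ headLen i ∸ 1)
    e = begin
        suc q ∸ headLen i ∸ 1 ≡⟨ cong (_∸ 1) (+-∸-assoc 1 (<⇒≤ h)) ⟩
        suc (q ∸ headLen i) ∸ 1 ≡⟨ refl ⟩
        q ∸ headLen i ≡⟨ sym (suc-pred (q ∸ headLen i) ⦃ >-nonZero (m<n⇒0<n∸m h) ⦄) ⟩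
        suc (q ∸ headLen i ∸ 1) ∎
      where open ≡-Reasoning

  freePos<freeLen : ∀ i q → headLen i < q → q + tailLen i < l i → q ∸ headLen i ∸ 1 < freeLen i
  freePos<freeLen i q head<q q+tail<l = <-≤-trans (pred< (m<n⇒0<n∸m head<q)) q∸head≤
    where
    pred< : ∀ {x} → 1 ≤ x → x ∸ 1 < x
    pred< {suc x} _ = ≤-refl
    q+tail≤ : q + tailLen i ≤ headLen i + freeLen i + tailLen i
    q+tail≤ = begin
        q + tailLen i                     ≤⟨ ≤-pred (≤-trans q+tail<l (≤-reflexive (sym (suc[l∸1] i)))) ⟩
        l i ∸ 1                           ≡⟨ sym (head+tail+free i) ⟩
        headLen i + tailLen i + freeLen i ≡⟨ solve 3 (λ h t f → h :+ t :+ f := h :+ f :+ t)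
                                               refl (headLen i) (tailLen i) (freeLen i) ⟩
        headLen i + freeLen i + tailLen i ∎
      where open ≤-Reasoning
    q∸head≤ : q ∸ headLen i ≤ freeLen i
    q∸head≤ = ≤-trans (∸-monoˡ-≤ (headLen i) (+-cancelʳ-≤ (tailLen i) q _ q+tail≤))
                      (≤-reflexive (m+n∸m≡n (headLen i) (freeLen i)))

  freeIndex<freeTotal : ∀ i q → headLen i < q → q + tailLen i < l i → freeIndex i q < freeTotal
  freeIndex<freeTotal i q head<q q+tail<l =
    <-≤-trans (+-monoʳ-< (prefixSum freeLen i) (freePos<freeLen i q head<q q+tail<l)) (prefixSum+term≤sum freeLen i)

  th₁≤topRoom : th₁ ≤ topRoom
  th₁≤topRoom = m⊓n≤m topRoom freeTotal

  th₁≤freeTotal : th₁ ≤ freeTotal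
  th₁≤freeTotal = m⊓n≤n topRoom freeTotal

  secondFree≤rest₁ : secondFree ≤ rest₁
  secondFree≤rest₁ = m⊓n≤n secondRoom rest₁

  secondFree≤secondRoom : secondFree ≤ secondRoom
  secondFree≤secondRoom = m⊓n≤m secondRoom rest₁

  th₁≤th₂ : th₁ ≤ th₂
  th₁≤th₂ = m≤m+n th₁ midCount

  freeTotal∸th₂ : freeTotal ∸ th₂ ≡ secondFree
  freeTotal∸th₂ = begin
      freeTotal ∸ (th₁ + midCount) ≡⟨ sym (∸-+-assoc freeTotal th₁ midCount) ⟩
      rest₁ ∸ midCount ≡⟨ m∸[m∸n]≡n secondFree≤rest₁ ⟩
      secondFree ∎
    where open ≡-Reasoning

  freeSlot-top : ∀ c → c < th₁ → freeSlot c ≡ top (4 + m′ + c)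
  freeSlot-top c h with c <? th₁
  ... | yes _ = refl
  ... | no n = ⊥-elim (n h)

  freeSlot-ranked : ∀ c → th₁ ≤ c → c < th₂ → freeSlot c ≡ ranked (midBase + (c ∸ th₁))
  freeSlot-ranked c h1 h2 with c <? th₁
  ... | yes y = ⊥-elim (<⇒≱ y h1)
  ... | no _ with c <? th₂
  ... | yes _ = refl
  ... | no n = ⊥-elim (n h2)

  freeSlot-second : ∀ c → th₂ ≤ c → freeSlot c ≡ second (secondBase + (c ∸ th₂))
  freeSlot-second c h with c <? th₁
  ... | yes y = ⊥-elim (<⇒≱ y (≤-trans th₁≤th₂ h))
  ... | no _ with c <? th₂
  ... | yes y = ⊥-elim (<⇒≱ y h)
  ... | no _ = refl

  -- Counting: n = (m + 3) + (secondBase + 2) + freeTotal, so when there are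
  -- middle vertices at all, both special blocks are full and they fit into
  -- the Q ∸ 2 lower blocks.

  sumFin-headLen : sumFin headLen ≡ 5 + m′
  sumFin-headLen = cong (λ z → 5 + z) (sumFin-const1 m′)

  sumFin-tailLen : sumFin tailLen ≡ δ₀ + (δ₁ + (2 + δ₂ + m′))
  sumFin-tailLen = cong (λ z → δ₀ + (δ₁ + (2 + δ₂ + z))) (sumFin-const1 m′)

  order-split : order ≡ (6 + m′) + (secondBase + 2) + freeTotal
  order-split = begin
      order ≡⟨ order-eq ⟩
      2 + sumFin (λ i → l i ∸ 1) ≡⟨ cong (2 +_) (sumFin-cong (λ i → sym (head+tail+free i))) ⟩
      2 + sumFin (λ i → headLen i + tailLen i + freeLen i) ≡⟨ cong (2 +_) (sumFin-+ (λ i → headLen i + tailLen i) freeLen) ⟩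
      2 + (sumFin (λ i → headLen i + tailLen i) + freeTotal) ≡⟨ cong (λ z → 2 + (z + freeTotal)) (sumFin-+ headLen tailLen) ⟩
      2 + (sumFin headLen + sumFin tailLen + freeTotal) ≡⟨ cong₂ (λ x y → 2 + (x + y + freeTotal)) sumFin-headLen sumFin-tailLen ⟩
      2 + ((5 + m′) + (δ₀ + (δ₁ + (2 + δ₂ + m′))) + freeTotal) ≡⟨ solve 5 (λ m a b c f →
          con 2 :+ ((con 5 :+ m) :+ (a :+ (b :+ (con 2 :+ c :+ m))) :+ f) :=
          (con 6 :+ m) :+ ((con 1 :+ m :+ a :+ b :+ c) :+ con 2) :+ f) refl m′ δ₀ δ₁ δ₂ freeTotal ⟩
      (6 + m′) + (secondBase + 2) + freeTotal ∎
    where open ≡-Reasoning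

  δ₀≤1 : δ₀ ≤ 1
  δ₀≤1 = ind≥3≤1 (l i0)

  secondBase+2≤k : secondBase + 2 ≤ k
  secondBase+2≤k = ≤-trans le k≥m+3
    where
    le : secondBase + 2 ≤ 6 + m′
    le = begin
        suc m′ + δ₀ + δ₁ + δ₂ + 2 ≤⟨ +-monoˡ-≤ 2 (+-mono-≤ (+-mono-≤ (+-monoʳ-≤ (suc m′) δ₀≤1) (ind≥5≤1 (l i1))) (ind≥5≤1 (l i2))) ⟩
        suc m′ + 1 + 1 + 1 + 2 ≡⟨ solve 1 (λ m → con 1 :+ m :+ con 1 :+ con 1 :+ con 1 :+ con 2 := con 6 :+ m) refl m′ ⟩
        6 + m′ ∎
      where open ≤-Reasoning

  order≤Q*k : order ≤ Q * k
  order≤Q*k = +-cancelʳ-≤ k1 order (Q * k) (begin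
      order + k1 ≡⟨ m≡m%n+[m/n]*n (order + k1) k ⟩
      (order + k1) % k + Q * k ≤⟨ +-monoˡ-≤ (Q * k) (≤-pred (m%n<n (order + k1) k)) ⟩
      k1 + Q * k ≡⟨ +-comm k1 (Q * k) ⟩
      Q * k + k1 ∎)
    where open ≤-Reasoning

  midCount>0 : 0 < midCount → th₁ ≡ topRoom × secondFree ≡ secondRoom
  midCount>0 mid>0 = th₁≡ , secondFree≡
    where
    rest₁>0 : 0 < rest₁
    rest₁>0 = <-≤-trans mid>0 (m∸n≤m rest₁ secondFree)
    th₁≡ : th₁ ≡ topRoom
    th₁≡ with topRoom ≤? freeTotal
    ... | yes fits = m≤n⇒m⊓n≡m fits
    ... | no ¬fits = ⊥-elim (<⇒≱ rest₁>0 (≤-reflexive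
                   (trans (cong (freeTotal ∸_) (m≥n⇒m⊓n≡n (<⇒≤ (≰⇒> ¬fits)))) (n∸n≡0 freeTotal))))
    secondFree≡ : secondFree ≡ secondRoom
    secondFree≡ with secondRoom ≤? rest₁
    ... | yes fits = m≤n⇒m⊓n≡m fits
    ... | no ¬fits = ⊥-elim (<⇒≱ mid>0 (≤-reflexive
                   (trans (cong (rest₁ ∸_) (m≥n⇒m⊓n≡n (<⇒≤ (≰⇒> ¬fits)))) (n∸n≡0 rest₁))))

  order≡k+k+midCount : 0 < midCount → order ≡ k + k + midCount
  order≡k+k+midCount mid>0 = begin
      order
        ≡⟨ order-split ⟩
      (6 + m′) + (secondBase + 2) + freeTotal
        ≡⟨ cong ((6 + m′) + (secondBase + 2) +_) freeTotal≡ ⟩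
      (6 + m′) + (secondBase + 2) + (topRoom + (secondRoom + midCount))
        ≡⟨ solve 5 (λ x y u w d → x :+ y :+ (u :+ (w :+ d)) := (x :+ u) :+ (y :+ w) :+ d)
             refl (6 + m′) (secondBase + 2) topRoom secondRoom midCount ⟩
      ((6 + m′) + topRoom) + ((secondBase + 2) + secondRoom) + midCount
        ≡⟨ cong₂ (λ x y → x + y + midCount) (m+[n∸m]≡n k≥m+3) (m+[n∸m]≡n secondBase+2≤k) ⟩
      k + k + midCount ∎
    where
    open ≡-Reasoning
    freeTotal≡ : freeTotal ≡ topRoom + (secondRoom + midCount)
    freeTotal≡ = begin
        freeTotal                     ≡⟨ sym (m+[n∸m]≡n th₁≤freeTotal) ⟩
        th₁ + rest₁                   ≡⟨ cong (th₁ +_) (sym (m+[n∸m]≡n secondFree≤rest₁)) ⟩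
        th₁ + (secondFree + midCount) ≡⟨ cong₂ (λ x y → x + (y + midCount)) (proj₁ (midCount>0 mid>0)) (proj₂ (midCount>0 mid>0)) ⟩
        topRoom + (secondRoom + midCount) ∎

  midCount≤ : midCount ≤ (Q ∸ 2) * k
  midCount≤ with midCount ≟ 0
  ... | yes mid≡0 = ≤-trans (≤-reflexive mid≡0) z≤n
  ... | no mid≢0 = begin
      midCount                   ≡⟨ sym (m+n∸m≡n (k + k) midCount) ⟩
      k + k + midCount ∸ (k + k) ≡⟨ cong (_∸ (k + k)) (sym (order≡k+k+midCount (n≢0⇒n>0 mid≢0))) ⟩
      order ∸ (k + k)            ≤⟨ ∸-monoˡ-≤ (k + k) order≤Q*k ⟩
      Q * k ∸ (k + k)            ≡⟨ cong (Q * k ∸_) (cong (k +_) (sym (+-identityʳ k))) ⟩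
      Q * k ∸ 2 * k              ≡⟨ sym (*-distribʳ-∸ k Q 2) ⟩
      (Q ∸ 2) * k                ∎
    where open ≤-Reasoning

  Q≥1 : 1 ≤ Q
  Q≥1 = m≥n⇒m/n>0 {order + k1} {k} (+-monoˡ-≤ k1 nV≥1)
    where
    nV≥1 : 1 ≤ order
    nV≥1 = ≤-trans (s≤s z≤n) (≤-reflexive (sym order-eq))

  Q≥2 : k < order → 2 ≤ Q
  Q≥2 k<n = ≤-trans (≤-reflexive (sym (m*n/n≡m 2 k))) (/-monoˡ-≤ k le)
    where
    le : 2 * k ≤ order + k1
    le = ≤-trans (≤-reflexive (solve 1 (λ k → con 2 :* (con 1 :+ k) := (con 2 :+ k) :+ k) refl k1)) (+-monoˡ-≤ k1 k<n)

  blockOf-top : ∀ y → InTop y → blockOf y ≡ Q ∸ 1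
  blockOf-top y (o , e) = cong slotBlock e

  blockOf-second : ∀ y → InSecond y → blockOf y ≡ Q ∸ 2
  blockOf-second y (o , e) = cong slotBlock e

  InLastTwo : Vertex → Set
  InLastTwo y = InTop y ⊎ InSecond y

  top-notBelowTop : ∀ y → InTop y → ¬ (blockOf y < Q ∸ 1)
  top-notBelowTop y h lt = <-irrefl (blockOf-top y h) lt

  lastTwo-block≥ : ∀ y → InLastTwo y → Q ∸ 2 ≤ blockOf y
  lastTwo-block≥ y (inj₁ h) = ≤-trans (∸-monoʳ-≤ Q (n≤1+n 1)) (≤-reflexive (sym (blockOf-top y h)))
  lastTwo-block≥ y (inj₂ h) = ≤-reflexive (sym (blockOf-second y h))

  lastTwo-notBelowSecond : ∀ y → InLastTwo y → ¬ (blockOf y < Q ∸ 2)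
  lastTwo-notBelowSecond y h lt = <⇒≱ lt (lastTwo-block≥ y h)

  lastTwo-notBelow : ∀ y X → X < Q ∸ 2 → InLastTwo y → ¬ (blockOf y < X)
  lastTwo-notBelow y X hX h lt = <⇒≱ (<-trans lt hX) (lastTwo-block≥ y h)

  headLen≥1 : ∀ i → 1 ≤ headLen i
  headLen≥1 zero = s≤s z≤n
  headLen≥1 (suc zero) = s≤s z≤n
  headLen≥1 (suc (suc i)) = s≤s z≤n

  headOrTail⇒lastTwo : ∀ i q → q ≤ headLen i ⊎ l i ≤ q + tailLen i → InLastTwo (pathVertex i q)
  headOrTail⇒lastTwo i q h with q ≤? headLen i
  ... | yes y = inj₁ (head⇒top i q y)
  ... | no ny with h
  ... | inj₁ y = ⊥-elim (ny y)
  ... | inj₂ y = inj₂ (tail⇒second i q (≰⇒> ny) y)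

  ind≥3-pos : ∀ L → 1 < L ∸ 1 → 1 ≤ ind≥3 L
  ind≥3-pos (suc (suc (suc L))) _ = s≤s z≤n
  ind≥3-pos zero ()
  ind≥3-pos (suc zero) ()
  ind≥3-pos (suc (suc zero)) (s≤s ())

  ind≥5-pos : ∀ L → 3 < L ∸ 1 → 1 ≤ ind≥5 L
  ind≥5-pos (suc (suc (suc (suc (suc L))))) _ = s≤s z≤n
  ind≥5-pos zero ()
  ind≥5-pos (suc zero) ()
  ind≥5-pos (suc (suc zero)) (s≤s ())
  ind≥5-pos (suc (suc (suc zero))) (s≤s (s≤s ()))
  ind≥5-pos (suc (suc (suc (suc zero)))) (s≤s (s≤s (s≤s ())))

  tailLen-pos : ∀ i → headLen i < l i ∸ 1 → 1 ≤ tailLen i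
  tailLen-pos zero h = ind≥3-pos (l zero) h
  tailLen-pos (suc zero) h = ind≥5-pos (l (suc zero)) h
  tailLen-pos (suc (suc zero)) h = s≤s z≤n
  tailLen-pos (suc (suc (suc i))) h = s≤s z≤n

  lastInner-lastTwo : ∀ i → InLastTwo (pathVertex i (l i ∸ 1))
  lastInner-lastTwo i = headOrTail⇒lastTwo i (l i ∸ 1) h
    where
    h : l i ∸ 1 ≤ headLen i ⊎ l i ≤ l i ∸ 1 + tailLen i
    h with l i ∸ 1 ≤? headLen i
    ... | yes y = inj₁ y
    ... | no ny = inj₂ (begin
        l i ≡⟨ sym (suc[l∸1] i) ⟩
        suc (l i ∸ 1) ≡⟨ +-comm 1 _ ⟩
        l i ∸ 1 + 1 ≤⟨ +-monoʳ-≤ (l i ∸ 1) (tailLen-pos i (≰⇒> ny)) ⟩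
        l i ∸ 1 + tailLen i ∎)
      where open ≤-Reasoning

  firstInner-top : ∀ i → InTop (pathVertex i 1)
  firstInner-top i = head⇒top i 1 (headLen≥1 i)

  midRank< : ∀ t → t < midCount → midBase + t < (Q ∸ 2) * k
  midRank< t h = begin-strict
      midBase + t <⟨ +-monoʳ-< midBase h ⟩
      midBase + midCount ≡⟨ m∸n+n≡m midCount≤ ⟩
      (Q ∸ 2) * k ∎
    where open ≤-Reasoning

  midRank-block : ∀ t → t < midCount → (midBase + t) / k < Q ∸ 2
  midRank-block t h = m<n*o⇒m/o<n (midRank< t h)

  bound-via : ∀ {t b o} → t ≤ b → b + o < k → t + o < k
  bound-via {o = o} t≤b b+o<k = ≤-<-trans (+-monoˡ-≤ o t≤b) b+o<k

  ≤k-via : ∀ x d → x + d ≡ 6 + m′ → x ≤ k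
  ≤k-via x d x+d≡ = ≤-trans (m≤m+n x d) (≤-trans (≤-reflexive x+d≡) k≥m+3)

  1+[k1∸1]≡k1 : 1 + (k1 ∸ 1) ≡ k1
  1+[k1∸1]≡k1 = m+[n∸m]≡n (≤-trans (s≤s z≤n) (≤-pred (≤-trans (s≤s (s≤s (s≤s (s≤s (s≤s (s≤s z≤n)))))) k≥m+3)))

  module TallyTop    = Tally (λ y → blockOf y <? (Q ∸ 1))
  module TallySecond = Tally (λ y → blockOf y <? (Q ∸ 2))

  tallyTop-reject : ∀ y → InTop y → TallyTop.tally (y ∷ []) ≤ 0
  tallyTop-reject y y∈top = TallyTop.tally-reject y (top-notBelowTop y y∈top)

  tallySecond-reject : ∀ y → InLastTwo y → TallySecond.tally (y ∷ []) ≤ 0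
  tallySecond-reject y y∈ = TallySecond.tally-reject y (lastTwo-notBelowSecond y y∈)

  tu-top : InTop tu
  tu-top = 1 , refl

  firstInners-top : TallyTop.tally firstInners ≤ 0
  firstInners-top = TallyTop.tally-firstInners-none (λ i → top-notBelowTop (pathVertex i 1) (firstInner-top i))

  -- Path 0, position 1, offset 2: u and the other second vertices are in the
  -- top block; if l₀ = 2 it is also next to the m ∸ 1 other last inner vertices.
  headBound₀ : TallyTop.tally (innerNbrs i0 1) + 2 < k
  headBound₀ with l zero ≟ 2
  ... | yes l₀≡2 = bound-via (TallyTop.tally-innerNbrs zero 1 1 0 (suc (suc m′))
          (TallyTop.tally-pathNbrs zero 1 0 1 0 0 (tallyTop-reject tu tu-top) (TallyTop.tally-single _)
             (λ { (s≤s ()) }) (λ lt → ⊥-elim (<⇒≱ lt (≤-reflexive l₀≡2))))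
          (λ _ → firstInners-top)
          (λ _ → count-map-allFin (λ y → blockOf y <? (Q ∸ 1)) (λ i → pathVertex i (l i ∸ 1))
                   (top-notBelowTop (pathVertex zero (l zero ∸ 1))
                      (subst InTop (cong (λ z → pathVertex zero (z ∸ 1)) (sym l₀≡2)) (firstInner-top zero)))))
          (≤k-via _ 0 (solve 1 (λ m → con 1 :+ (con 3 :+ m :+ con 2) :+ con 0 := con 6 :+ m) refl m′))
  ... | no l₀≢2 = bound-via (TallyTop.tally-innerNbrs zero 1 2 0 0
          (TallyTop.tally-pathNbrs zero 1 0 1 0 1 (tallyTop-reject tu tu-top) (TallyTop.tally-single _)
             (λ { (s≤s ()) }) (λ _ → TallyTop.tally-single _))
          (λ _ → firstInners-top)
          (λ l≡2 → ⊥-elim (l₀≢2 (sym l≡2))))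
          (≤k-via _ (suc m′) (solve 1 (λ m → con 5 :+ (con 1 :+ m) := con 6 :+ m) refl m′))

  -- Path 1, positions 1, 2, 3 at offsets k ∸ 1, k ∸ 2, 0: position 1 has no
  -- earlier neighbours, position 2 at most position 4, and position 3 at most
  -- positions 4, 5 and the m last inner vertices.
  headBound₁ : ∀ p → 1 ≤ p → p ≤ 3 → TallyTop.tally (innerNbrs i1 p) + headOffset i1 p < k
  headBound₁ 1 _ _ = bound-via {b = 0} (TallyTop.tally-innerNbrs i1 1 0 0 0
          (TallyTop.tally-pathNbrs i1 1 0 0 0 0 (tallyTop-reject tu tu-top)
             (tallyTop-reject _ (head⇒top i1 2 (s≤s (s≤s z≤n)))) (λ { (s≤s ()) })
             (λ _ → tallyTop-reject _ (head⇒top i1 3 ≤-refl)))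
          (λ _ → firstInners-top)
          (λ l≡2 → ⊥-elim (<⇒≱ (≤-trans (s≤s (s≤s (s≤s z≤n))) l₁≥4) (≤-reflexive (sym l≡2)))))
          ≤-refl
  headBound₁ 2 _ _ = bound-via {b = 1} (TallyTop.tally-innerNbrs i1 2 1 0 0
          (TallyTop.tally-pathNbrs i1 2 0 0 0 1 (tallyTop-reject _ (firstInner-top i1))
             (tallyTop-reject _ (head⇒top i1 3 ≤-refl)) (λ _ → tallyTop-reject tu tu-top) (λ _ → TallyTop.tally-single _))
          (λ ())
          (λ l≡3 → ⊥-elim (<⇒≱ (≤-trans (s≤s (s≤s (s≤s (s≤s z≤n)))) l₁≥4) (≤-reflexive (sym l≡3)))))
          (s≤s (≤-reflexive 1+[k1∸1]≡k1))
  headBound₁ 3 _ _ = bound-via {b = 2 + m} (TallyTop.tally-innerNbrs i1 3 2 0 m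
          (TallyTop.tally-pathNbrs i1 3 0 1 0 1 (tallyTop-reject _ (head⇒top i1 2 (s≤s (s≤s z≤n))))
             (TallyTop.tally-single _) (λ _ → tallyTop-reject _ (firstInner-top i1)) (λ _ → TallyTop.tally-single _))
          (λ ())
          (λ _ → TallyTop.tally-lastInners≤m))
          (≤k-via _ 0 (solve 1 (λ m → con 1 :+ (con 2 :+ (con 3 :+ m) :+ con 0) :+ con 0 := con 6 :+ m) refl m′))
  headBound₁ (suc (suc (suc (suc _)))) _ (s≤s (s≤s (s≤s ())))

  -- Path i ≥ 2, position 1, offset i + 1: only positions 2 and 3 can be earlier.
  headBound₊ : ∀ i → TallyTop.tally (innerNbrs (suc (suc i)) 1) + (3 + toℕ i) < k
  headBound₊ i = bound-via {b = 2} (TallyTop.tally-innerNbrs (suc (suc i)) 1 2 0 0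
          (TallyTop.tally-pathNbrs (suc (suc i)) 1 0 1 0 1 (tallyTop-reject tu tu-top) (TallyTop.tally-single _)
             (λ { (s≤s ()) }) (λ _ → TallyTop.tally-single _))
          (λ _ → firstInners-top)
          (λ l≡2 → ⊥-elim (<⇒≱ (≤-trans (s≤s (s≤s (s≤s z≤n))) (l≥4 (suc (suc i)) (s≤s z≤n))) (≤-reflexive (sym l≡2)))))
          (≤-trans (s≤s (+-monoʳ-≤ 5 (≤-pred (toℕ<n i))))
            (≤-trans (≤-reflexive (cong suc (+-comm 5 m′))) (≤-trans (≤-reflexive (+-comm (suc m′) 5)) k≥m+3)))

  headBound : ∀ i p → 1 ≤ p → p ≤ headLen i → TallyTop.tally (innerNbrs i p) + headOffset i p < k
  headBound zero          1 _ _          = headBound₀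
  headBound zero          (suc (suc _)) _ (s≤s ())
  headBound (suc zero)    p 1≤p p≤3      = headBound₁ p 1≤p p≤3
  headBound (suc (suc i)) 1 _ _          = headBound₊ i
  headBound (suc (suc i)) (suc (suc _)) _ (s≤s ())

  lastInners-second : TallySecond.tally lastInners ≤ 0
  lastInners-second = TallySecond.tally-lastInners-none
    (λ i → lastTwo-notBelowSecond (pathVertex i (l i ∸ 1)) (lastInner-lastTwo i))

  -- A last inner vertex that is not in the head has at most two earlier
  -- neighbours: positions p ∸ 1 and p ∸ 2 on its path.
  lastInnerTally : ∀ i p → suc p ≡ l i → 2 ≤ p → headLen i < p → TallySecond.tally (innerNbrs i p) ≤ 2
  lastInnerTally i p p+1≡l 2≤p head<p = TallySecond.tally-innerNbrs i p 2 0 0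
    (TallySecond.tally-pathNbrs i p 1 0 1 0 (TallySecond.tally-single _)
      (tallySecond-reject (pathVertex i (suc p)) (inj₂ (tail⇒second i (suc p) (≤-trans head<p (n≤1+n p))
        (≤-trans (≤-reflexive (sym p+1≡l)) (m≤m+n (suc p) (tailLen i))))))
      (λ _ → TallySecond.tally-single _) (λ lt → ⊥-elim (<-irrefl p+1≡l lt)))
    (λ p≡1 → ⊥-elim (<⇒≱ 2≤p (≤-reflexive p≡1)))
    (λ _ → lastInners-second)

  last-position : ∀ L p s → p < L → L ≤ p + s → s ≤ 1 → suc p ≡ L
  last-position L p s p<L L≤p+s s≤1 = ≤-antisym p<L (≤-trans L≤p+s (≤-trans (+-monoʳ-≤ p s≤1) (≤-reflexive (+-comm p 1))))

  δ₂≡1 : 5 ≤ l i2 → δ₂ ≡ 1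
  δ₂≡1 l₂≥5 = ≤-antisym (ind≥5≤1 (l i2)) (ind≥5-pos (l i2) (≤-trans (s≤s (s≤s (s≤s (s≤s z≤n)))) (∸-monoˡ-≤ 1 l₂≥5)))

  back2-lastTwo : ∀ p → suc p ≡ l i2 → 1 < p → p ∸ 2 ≤ headLen i2 ⊎ l i2 ≤ p ∸ 2 + tailLen i2
  back2-lastTwo (suc (suc zero)) _ _ = inj₁ z≤n
  back2-lastTwo (suc (suc (suc zero))) _ _ = inj₁ ≤-refl
  back2-lastTwo (suc (suc (suc (suc q)))) e _ = inj₂ (≤-reflexive (trans (sym e)
    (trans (solve 1 (λ q → con 5 :+ q := con 2 :+ q :+ (con 2 :+ con 1)) refl q)
           (cong (λ z → suc (suc q) + (2 + z)) (sym (δ₂≡1 (≤-trans (s≤s (s≤s (s≤s (s≤s (s≤s z≤n))))) (≤-reflexive e))))))))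
  back2-lastTwo zero _ ()
  back2-lastTwo (suc zero) _ (s≤s ())

  back1-lastTwo : ∀ p → suc (suc p) ≡ l i2 → 1 < p → p ∸ 1 ≤ headLen i2 ⊎ l i2 ≤ p ∸ 1 + tailLen i2
  back1-lastTwo (suc (suc zero)) _ _ = inj₁ ≤-refl
  back1-lastTwo (suc (suc (suc q))) e _ = inj₂ (≤-reflexive (trans (sym e)
    (trans (solve 1 (λ q → con 5 :+ q := con 2 :+ q :+ (con 2 :+ con 1)) refl q)
           (cong (λ z → suc (suc q) + (2 + z)) (sym (δ₂≡1 (≤-trans (s≤s (s≤s (s≤s (s≤s (s≤s z≤n))))) (≤-reflexive e))))))))
  back1-lastTwo zero _ ()
  back1-lastTwo (suc zero) _ (s≤s ())

  tailOffset₂-last : ∀ p → suc p ≡ l i2 → tailOffset i2 p ≡ k1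
  tailOffset₂-last p e with suc p ≟ l i2
  ... | yes _ = refl
  ... | no n = ⊥-elim (n e)

  tailOffset₂-secondLast : ∀ p → suc p ≢ l i2 → suc (suc p) ≡ l i2 → tailOffset i2 p ≡ k1 ∸ 1
  tailOffset₂-secondLast p n1 e with suc p ≟ l i2
  ... | yes y = ⊥-elim (n1 y)
  ... | no _ with suc (suc p) ≟ l i2
  ... | yes _ = refl
  ... | no n = ⊥-elim (n e)

  tailOffset₂-thirdLast : ∀ p → suc p ≢ l i2 → suc (suc p) ≢ l i2 → tailOffset i2 p ≡ suc m′ + δ₀ + δ₁
  tailOffset₂-thirdLast p n1 n2 with suc p ≟ l i2
  ... | yes y = ⊥-elim (n1 y)
  ... | no _ with suc (suc p) ≟ l i2
  ... | yes y = ⊥-elim (n2 y)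
  ... | no _ = refl

  back1-tail : ∀ p → suc p ≡ l i2 → 1 < p → l i2 ≤ p ∸ 1 + tailLen i2
  back1-tail p e ht = begin
      l i2 ≡⟨ sym e ⟩
      suc p ≡⟨ cong suc (sym (suc-pred p ⦃ >-nonZero (≤-trans (s≤s z≤n) ht) ⦄)) ⟩
      suc (suc (p ∸ 1)) ≡⟨ +-comm 2 (p ∸ 1) ⟩
      p ∸ 1 + 2 ≤⟨ +-monoʳ-≤ (p ∸ 1) (m≤m+n 2 δ₂) ⟩
      p ∸ 1 + tailLen i2 ∎
    where open ≤-Reasoning

  next-tail : ∀ p → suc (suc p) ≡ l i2 → l i2 ≤ suc p + tailLen i2
  next-tail p e = ≤-trans (≤-reflexive (sym e))
      (≤-trans (≤-reflexive (+-comm 2 p)) (≤-trans (+-monoʳ-≤ p (m≤m+n 2 δ₂)) (+-monoˡ-≤ (tailLen i2) (n≤1+n p))))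

  -- Path 2, last inner vertex, offset k ∸ 1: all its neighbours are in the
  -- last two blocks.
  tailBound₂-last : ∀ p → suc p ≡ l i2 → headLen i2 < p →
    TallySecond.tally (innerNbrs i2 p) + tailOffset i2 p < k
  tailBound₂-last p e ht = subst (λ o → TallySecond.tally (innerNbrs i2 p) + o < k) (sym (tailOffset₂-last p e))
    (bound-via {b = 0} (TallySecond.tally-innerNbrs i2 p 0 0 0
      (TallySecond.tally-pathNbrs i2 p 0 0 0 0
        (tallySecond-reject (pathVertex i2 (p ∸ 1)) (headOrTail⇒lastTwo i2 (p ∸ 1) (inj₂ (back1-tail p e ht))))
        (tallySecond-reject (pathVertex i2 (suc p)) (inj₂ (tail⇒second i2 (suc p) (≤-trans ht (n≤1+n p))
          (≤-trans (≤-reflexive (sym e)) (m≤m+n (suc p) _)))))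
        (λ _ → tallySecond-reject (pathVertex i2 (p ∸ 2)) (headOrTail⇒lastTwo i2 (p ∸ 2) (back2-lastTwo p e ht)))
        (λ lt → ⊥-elim (<-irrefl e lt)))
      (λ p≡1 → ⊥-elim (<⇒≱ ht (≤-reflexive p≡1)))
      (λ _ → lastInners-second))
      (s≤s ≤-refl))

  -- Path 2, second-to-last inner vertex, offset k ∸ 2: only position p ∸ 2
  -- can be earlier.
  tailBound₂-secondLast : ∀ p → suc p ≢ l i2 → suc (suc p) ≡ l i2 → headLen i2 < p →
    TallySecond.tally (innerNbrs i2 p) + tailOffset i2 p < k
  tailBound₂-secondLast p ne e ht = subst (λ o → TallySecond.tally (innerNbrs i2 p) + o < k)
    (sym (tailOffset₂-secondLast p ne e))
    (bound-via {b = 1} (TallySecond.tally-innerNbrs i2 p 1 0 0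
      (TallySecond.tally-pathNbrs i2 p 0 0 1 0
        (tallySecond-reject (pathVertex i2 (p ∸ 1)) (headOrTail⇒lastTwo i2 (p ∸ 1) (back1-lastTwo p e ht)))
        (tallySecond-reject (pathVertex i2 (suc p)) (inj₂ (tail⇒second i2 (suc p) (≤-trans ht (n≤1+n p)) (next-tail p e))))
        (λ _ → TallySecond.tally-single _)
        (λ _ → tallySecond-reject (pathVertex i2 (suc (suc p))) (inj₂ (tail⇒second i2 (suc (suc p))
          (≤-trans ht (≤-trans (n≤1+n p) (n≤1+n (suc p)))) (≤-trans (≤-reflexive (sym e)) (m≤m+n _ _))))))
      (λ p≡1 → ⊥-elim (<⇒≱ ht (≤-reflexive p≡1)))
      (λ e′ → ⊥-elim (ne e′)))
      (s≤s (≤-reflexive 1+[k1∸1]≡k1)))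

  -- Path 2, third-to-last inner vertex (when l₂ ≥ 5), offset m ∸ 2 + δ₀ + δ₁:
  -- positions p ∸ 1 and p ∸ 2 can be earlier.
  tailBound₂-thirdLast : ∀ p → suc p ≢ l i2 → suc (suc p) ≢ l i2 → headLen i2 < p → l i2 ≤ p + tailLen i2 →
    TallySecond.tally (innerNbrs i2 p) + tailOffset i2 p < k
  tailBound₂-thirdLast p ne ne₂ ht hs = subst (λ o → TallySecond.tally (innerNbrs i2 p) + o < k)
    (sym (tailOffset₂-thirdLast p ne ne₂))
    (bound-via {b = 2} (TallySecond.tally-innerNbrs i2 p 2 0 0
      (TallySecond.tally-pathNbrs i2 p 1 0 1 0 (TallySecond.tally-single _)
        (tallySecond-reject (pathVertex i2 (suc p)) (inj₂ (tail⇒second i2 (suc p) (≤-trans ht (n≤1+n p))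
          (≤-trans hs (+-monoˡ-≤ (tailLen i2) (n≤1+n p))))))
        (λ _ → TallySecond.tally-single _)
        (λ _ → tallySecond-reject (pathVertex i2 (suc (suc p))) (inj₂ (tail⇒second i2 (suc (suc p))
          (≤-trans ht (≤-trans (n≤1+n p) (n≤1+n (suc p))))
          (≤-trans hs (+-monoˡ-≤ (tailLen i2) (≤-trans (n≤1+n p) (n≤1+n (suc p)))))))))
      (λ p≡1 → ⊥-elim (<⇒≱ ht (≤-reflexive p≡1)))
      (λ e′ → ⊥-elim (ne e′)))
      (≤-trans (s≤s (s≤s (s≤s (+-mono-≤ (+-monoʳ-≤ (suc m′) δ₀≤1) (ind≥5≤1 (l i1))))))
        (≤k-via _ 0 (solve 1 (λ m → con 3 :+ (con 1 :+ m :+ con 1 :+ con 1) :+ con 0 := con 6 :+ m) refl m′))))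

  -- Tail vertices of the other paths are last inner vertices, at offsets
  -- m ∸ 2, m ∸ 2 + δ₀ (paths 0, 1) and i ∸ 2 (paths i ≥ 3).
  tailBound : ∀ i p → p < l i → headLen i < p → l i ≤ p + tailLen i →
    TallySecond.tally (innerNbrs i p) + tailOffset i p < k
  tailBound zero p lt ht hs =
    bound-via (lastInnerTally zero p (last-position (l zero) p _ lt hs (ind≥3≤1 (l zero))) ht ht)
      (≤k-via _ 2 (solve 1 (λ m → con 1 :+ (con 2 :+ (con 1 :+ m)) :+ con 2 := con 6 :+ m) refl m′))
  tailBound (suc zero) p lt ht hs =
    bound-via (lastInnerTally i1 p (last-position (l i1) p _ lt hs (ind≥5≤1 (l i1))) (≤-trans (s≤s (s≤s z≤n)) ht) ht)
      (≤-trans (s≤s (s≤s (s≤s (+-monoʳ-≤ (suc m′) δ₀≤1))))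
        (≤k-via _ 1 (solve 1 (λ m → con 3 :+ (con 1 :+ m :+ con 1) :+ con 1 := con 6 :+ m) refl m′)))
  tailBound (suc (suc (suc i))) p lt ht hs =
    bound-via (lastInnerTally (suc (suc (suc i))) p (last-position (l (suc (suc (suc i)))) p 1 lt hs ≤-refl) ht ht)
      (≤-trans (s≤s (s≤s (s≤s (toℕ<n i)))) (≤k-via _ 3 (solve 1 (λ m → con 3 :+ m :+ con 3 := con 6 :+ m) refl m′)))
  tailBound (suc (suc zero)) p lt ht hs = byPosition (suc p ≟ l i2) (suc (suc p) ≟ l i2)
    where
    byPosition : Dec (suc p ≡ l i2) → Dec (suc (suc p) ≡ l i2) →
      TallySecond.tally (innerNbrs i2 p) + tailOffset i2 p < k
    byPosition (yes e) _        = tailBound₂-last p e ht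
    byPosition (no ne) (yes e)  = tailBound₂-secondLast p ne e ht
    byPosition (no ne) (no ne₂) = tailBound₂-thirdLast p ne ne₂ ht hs

  freeIndex-mono : ∀ i q p → q ≤ p → freeIndex i q ≤ freeIndex i p
  freeIndex-mono i q p h = +-monoʳ-≤ (prefixSum freeLen i) (∸-monoˡ-≤ 1 (∸-monoˡ-≤ (headLen i) h))

  freeIndex-+ : ∀ i q d → headLen i < q → freeIndex i (q + d) ≡ freeIndex i q + d
  freeIndex-+ i q zero    _      = trans (cong (freeIndex i) (+-identityʳ q)) (sym (+-identityʳ _))
  freeIndex-+ i q (suc d) head<q = begin
      freeIndex i (q + suc d)   ≡⟨ cong (freeIndex i) (+-suc q d) ⟩
      freeIndex i (suc (q + d)) ≡⟨ freeIndex-suc i (q + d) (≤-trans head<q (m≤m+n q d)) ⟩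
      suc (freeIndex i (q + d)) ≡⟨ cong suc (freeIndex-+ i q d head<q) ⟩
      suc (freeIndex i q + d)   ≡⟨ sym (+-suc _ d) ⟩
      freeIndex i q + suc d     ∎
    where open ≡-Reasoning

  -- Free indices increase along a path, so a free vertex in the top block is
  -- preceded only by top-block vertices, and one in the second block is
  -- followed only by second-block vertices.
  before-topFree⇒top : ∀ i p q → headLen i < p → p + tailLen i < l i → freeIndex i p < th₁ → q ≤ p →
    InTop (pathVertex i q)
  before-topFree⇒top i p q h1 h2 h3 q≤p with q ≤? headLen i
  ... | yes inHead = head⇒top i q inHead
  ... | no notHead = 4 + m′ + freeIndex i q ,
          trans (slot-free i q (≰⇒> notHead) (≤-<-trans (+-monoˡ-≤ (tailLen i) q≤p) h2))
                (freeSlot-top (freeIndex i q) (≤-<-trans (freeIndex-mono i q p q≤p) h3))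

  after-secondFree⇒second : ∀ i p q → headLen i < p → th₂ ≤ freeIndex i p → p ≤ q → InSecond (pathVertex i q)
  after-secondFree⇒second i p q h1 h3 p≤q with l i ≤? q + tailLen i
  ... | yes inTail = tail⇒second i q (<-≤-trans h1 p≤q) inTail
  ... | no notTail = secondBase + (freeIndex i q ∸ th₂) ,
          trans (slot-free i q (<-≤-trans h1 p≤q) (≰⇒> notTail))
                (freeSlot-second (freeIndex i q) (≤-trans h3 (freeIndex-mono i p q p≤q)))

  free≢1 : ∀ i p → headLen i < p → p ≢ 1
  free≢1 i p head<p p≡1 = <⇒≱ head<p (≤-trans (≤-reflexive p≡1) (headLen≥1 i))

  -- A free vertex is neither a second nor a last inner vertex, so only its four
  -- path neighbours need to be counted.
  tally-freeNbrs : ∀ {P : Vertex → Set} (P? : ∀ y → Dec (P y)) i p → headLen i < p → p + tailLen i < l i →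
    ∀ b₋₁ b₊₁ b₋₂ b₊₂ →
    Tally.tally P? (pathVertex i (p ∸ 1) ∷ []) ≤ b₋₁ → Tally.tally P? (pathVertex i (suc p) ∷ []) ≤ b₊₁ →
    (2 ≤ p → Tally.tally P? (pathVertex i (p ∸ 2) ∷ []) ≤ b₋₂) →
    (suc p < l i → Tally.tally P? (pathVertex i (suc (suc p)) ∷ []) ≤ b₊₂) →
    Tally.tally P? (innerNbrs i p) ≤ b₋₁ + b₊₁ + b₋₂ + b₊₂ + (0 + 0)
  tally-freeNbrs P? i p h1 h2 b₋₁ b₊₁ b₋₂ b₊₂ h₋₁ h₊₁ h₋₂ h₊₂ =
    Tally.tally-innerNbrs P? i p _ 0 0 (Tally.tally-pathNbrs P? i p b₋₁ b₊₁ b₋₂ b₊₂ h₋₁ h₊₁ h₋₂ h₊₂)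
      (λ p≡1 → ⊥-elim (free≢1 i p h1 p≡1)) (λ p+1≡l → ⊥-elim (<-irrefl p+1≡l (free⇒hasSuccessor i p h1 h2)))

  -- A free vertex of the top block, at offset m + 1 + freeIndex: only its two
  -- successors on the path can be earlier.
  freeTopBound : ∀ i p → headLen i < p → p + tailLen i < l i → freeIndex i p < th₁ →
    TallyTop.tally (innerNbrs i p) + (4 + m′ + freeIndex i p) < k
  freeTopBound i p h1 h2 h3 = bound-via (tally-freeNbrs (λ y → blockOf y <? (Q ∸ 1)) i p h1 h2 0 1 0 1
      (tallyTop-reject (pathVertex i (p ∸ 1)) (before-topFree⇒top i p (p ∸ 1) h1 h2 h3 (m∸n≤m p 1)))
      (TallyTop.tally-single _)
      (λ _ → tallyTop-reject (pathVertex i (p ∸ 2)) (before-topFree⇒top i p (p ∸ 2) h1 h2 h3 (m∸n≤m p 2)))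
      (λ _ → TallyTop.tally-single _))
    (begin-strict
      2 + (4 + m′ + freeIndex i p) ≡⟨ solve 2 (λ m c → con 2 :+ (con 4 :+ m :+ c) := con 6 :+ m :+ c) refl m′ (freeIndex i p) ⟩
      6 + m′ + freeIndex i p       <⟨ +-monoʳ-< (6 + m′) (<-≤-trans h3 th₁≤topRoom) ⟩
      6 + m′ + topRoom             ≡⟨ m+[n∸m]≡n k≥m+3 ⟩
      k                            ∎)
    where open ≤-Reasoning

  -- A free vertex of the second block, at offset secondBase + (freeIndex ∸ th₂):
  -- only its two predecessors on the path can be earlier.
  freeSecondBound : ∀ i p → headLen i < p → p + tailLen i < l i → th₂ ≤ freeIndex i p →
    TallySecond.tally (innerNbrs i p) + (secondBase + (freeIndex i p ∸ th₂)) < k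
  freeSecondBound i p h1 h2 h3 = bound-via (tally-freeNbrs (λ y → blockOf y <? (Q ∸ 2)) i p h1 h2 1 0 1 0
      (TallySecond.tally-single _)
      (tallySecond-reject (pathVertex i (suc p)) (inj₂ (after-secondFree⇒second i p (suc p) h1 h3 (n≤1+n p))))
      (λ _ → TallySecond.tally-single _)
      (λ _ → tallySecond-reject (pathVertex i (suc (suc p)))
        (inj₂ (after-secondFree⇒second i p (suc (suc p)) h1 h3 (≤-trans (n≤1+n p) (n≤1+n (suc p)))))))
    (begin-strict
      2 + (secondBase + (freeIndex i p ∸ th₂))
        ≡⟨ solve 2 (λ b x → con 2 :+ (b :+ x) := b :+ con 2 :+ x) refl secondBase (freeIndex i p ∸ th₂) ⟩
      secondBase + 2 + (freeIndex i p ∸ th₂) <⟨ +-monoʳ-< (secondBase + 2) lt ⟩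
      secondBase + 2 + secondRoom            ≡⟨ m+[n∸m]≡n secondBase+2≤k ⟩
      k                                      ∎)
    where
    open ≤-Reasoning
    lt : freeIndex i p ∸ th₂ < secondRoom
    lt = <-≤-trans (∸-monoˡ-< (freeIndex<freeTotal i p h1 h2) h3)
                   (≤-trans (≤-reflexive freeTotal∸th₂) secondFree≤secondRoom)

  midRank : ℕ → ℕ
  midRank c = midBase + (c ∸ th₁)

  midRank-+ : ∀ c d → th₁ ≤ c → midRank (c + d) ≡ midRank c + d
  midRank-+ c d th₁≤c = trans (cong (midBase +_) (+-∸-comm d th₁≤c)) (sym (+-assoc midBase (c ∸ th₁) d))

  midRank-mono : ∀ c c' → c ≤ c' → midRank c ≤ midRank c'
  midRank-mono c c' h = +-monoʳ-≤ midBase (∸-monoˡ-≤ th₁ h)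

  midRank-block< : ∀ c → th₁ ≤ c → c < th₂ → midRank c / k < Q ∸ 2
  midRank-block< c y h = midRank-block (c ∸ th₁) (+-cancelˡ-< th₁ (c ∸ th₁) midCount (subst (_< th₂) (sym (m+[n∸m]≡n y)) h))

  -- The degree bound of a middle vertex at position p of path i, with rank r
  -- in block X = r / k: vertices after it on the path have larger rank or lie
  -- in the second block, vertices d ≤ r % k before it share its block, so
  -- only the (at most 4) path neighbours can be earlier, and only when
  -- r % k < 2.
  module _ (i : Fin m) (p : ℕ) (h1 : headLen i < p) (h2 : p + tailLen i < l i)
           (h3 : th₁ ≤ freeIndex i p) (h4 : freeIndex i p < th₂) where

    private
      c0 r X : ℕ
      c0 = freeIndex i p
      r = midRank c0
      X = r / k
      hX : X < Q ∸ 2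
      hX = midRank-block< c0 h3 h4

    midFwd : ∀ q → p ≤ q → ¬ (blockOf (pathVertex i q) < X)
    midFwd q hq with l i ≤? q + tailLen i
    ... | yes y = lastTwo-notBelow (pathVertex i q) X hX (inj₂ (tail⇒second i q (<-≤-trans h1 hq) y))
    ... | no ny with freeIndex i q <? th₂
    ... | no nz = lastTwo-notBelow (pathVertex i q) X hX
        (inj₂ (secondBase + (freeIndex i q ∸ th₂) , trans (slot-free i q (<-≤-trans h1 hq) (≰⇒> ny)) (freeSlot-second (freeIndex i q) (≮⇒≥ nz))))
    ... | yes z = λ lt → <⇒≱ lt (subst (X ≤_) (sym (cong slotBlock e)) (/-monoˡ-≤ k (midRank-mono c0 (freeIndex i q) (freeIndex-mono i p q hq))))
      where
      e : slot (pathVertex i q) ≡ ranked (midRank (freeIndex i q))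
      e = trans (slot-free i q (<-≤-trans h1 hq) (≰⇒> ny)) (freeSlot-ranked (freeIndex i q) (≤-trans h3 (freeIndex-mono i p q hq)) z)

    -- A free vertex d ≤ r % k positions before p either lies in the top
    -- block or has rank r ∸ d, which lies in the same block as r.
    midBack : ∀ d → d ≤ r % k → ¬ (blockOf (pathVertex i (p ∸ d)) < X)
    midBack d d≤r%k with (p ∸ d) ≤? headLen i
    ... | yes inHead = lastTwo-notBelow (pathVertex i (p ∸ d)) X hX (inj₁ (head⇒top i (p ∸ d) inHead))
    ... | no notHead with freeIndex i (p ∸ d) <? th₁
    ... | yes early = lastTwo-notBelow (pathVertex i (p ∸ d)) X hX (inj₁ (_ , trans (slot-free i (p ∸ d) head<q q+tail<l) (freeSlot-top _ early)))
      where
      head<q : headLen i < p ∸ d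
      head<q = ≰⇒> notHead
      q+tail<l : p ∸ d + tailLen i < l i
      q+tail<l = ≤-<-trans (+-monoˡ-≤ (tailLen i) (m∸n≤m p d)) h2
    ... | no notEarly = λ lt → <-irrefl sameBlock (subst (_< X) (cong slotBlock slot≡) lt)
      where
      head<q : headLen i < p ∸ d
      head<q = ≰⇒> notHead
      q+tail<l : p ∸ d + tailLen i < l i
      q+tail<l = ≤-<-trans (+-monoˡ-≤ (tailLen i) (m∸n≤m p d)) h2
      d≤p : d ≤ p
      d≤p = <⇒≤ (m∸n≢0⇒n<m (m>n⇒m∸n≢0 (≤-trans (s≤s z≤n) head<q)))
      cq : ℕ
      cq = freeIndex i (p ∸ d)
      c0≡ : c0 ≡ cq + d
      c0≡ = trans (cong (freeIndex i) (sym (m∸n+n≡m d≤p))) (freeIndex-+ i (p ∸ d) d head<q)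
      slot≡ : slot (pathVertex i (p ∸ d)) ≡ ranked (midRank cq)
      slot≡ = trans (slot-free i (p ∸ d) head<q q+tail<l)
        (freeSlot-ranked cq (≮⇒≥ notEarly) (≤-<-trans (≤-trans (m≤m+n cq d) (≤-reflexive (sym c0≡))) h4))
      rank≡ : midRank cq ≡ r ∸ d
      rank≡ = sym (trans (cong (λ c → midRank c ∸ d) c0≡)
        (trans (cong (_∸ d) (midRank-+ cq d (≮⇒≥ notEarly))) (m+n∸n≡m (midRank cq) d)))
      sameBlock : midRank cq / k ≡ X
      sameBlock = trans (cong (_/ k) rank≡) (div-sub r d d≤r%k)

    earlier? : ∀ y → Dec (blockOf y < X)
    earlier? y = blockOf y <? X

    rankedBound : Tally.tally earlier? (innerNbrs i p) + r % k < k
    rankedBound with 2 ≤? r % k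
    ... | yes 2≤r%k = bound-via {b = 0} (tally-freeNbrs earlier? i p h1 h2 0 0 0 0
          (Tally.tally-reject earlier? _ (midBack 1 (≤-trans (s≤s z≤n) 2≤r%k)))
          (Tally.tally-reject earlier? _ (midFwd (suc p) (n≤1+n p)))
          (λ _ → Tally.tally-reject earlier? _ (midBack 2 2≤r%k))
          (λ _ → Tally.tally-reject earlier? _ (midFwd (suc (suc p)) (≤-trans (n≤1+n p) (n≤1+n (suc p))))))
          (m%n<n r k)
    ... | no r%k<2 = bound-via {b = 4}
          (tally-freeNbrs earlier? i p h1 h2 1 1 1 1 (Tally.tally-single earlier? _) (Tally.tally-single earlier? _)
             (λ _ → Tally.tally-single earlier? _) (λ _ → Tally.tally-single earlier? _))
          (≤-trans (s≤s (+-monoʳ-≤ 4 (≤-pred (≰⇒> r%k<2)))) (≤-trans (s≤s (s≤s (s≤s (s≤s (s≤s (s≤s z≤n)))))) k≥m+3))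

  BoundAt : Vertex → Slot → Set
  BoundAt x Z = count (λ y → blockOf y <? slotBlock Z) (nbrs x) + slotOffset Z < k

  record SlotOK (x : Vertex) : Set where
    constructor slotOK
    field
      okSlot : Slot
      okSlot-eq : slot x ≡ okSlot
      okSlot-bound : BoundAt x okSlot
      okSlot-block : slotBlock okSlot < Q

  Q∸1<Q : Q ∸ 1 < Q
  Q∸1<Q = ≤-trans (≤-reflexive (sp Q≥1)) ≤-refl
    where
    sp : ∀ {x} → 1 ≤ x → suc (x ∸ 1) ≡ x
    sp {suc x} _ = refl

  Q∸2<Q : Q ∸ 2 < Q
  Q∸2<Q = ≤-<-trans (∸-monoʳ-≤ Q (n≤1+n 1)) Q∸1<Q

  slotOK-tu : SlotOK tu
  slotOK-tu = slotOK (top 1) refl (bound-via (count-concat-map-allFin (λ y → blockOf y <? (Q ∸ 1)) (λ i → pathVertex i 1 ∷ pathVertex i 2 ∷ [])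
      (λ i → ≤-trans (≤-reflexive (count-reject (λ y → blockOf y <? (Q ∸ 1)) (pathVertex i 1) _
          (top-notBelowTop (pathVertex i 1) (firstInner-top i)))) (TallyTop.tally-single _)))
    (≤k-via _ 1 (solve 1 (λ m → con 1 :+ (con 3 :+ m :+ con 1) :+ con 1 := con 6 :+ m) refl m′))) Q∸1<Q

  slotOK-tw : SlotOK tw
  slotOK-tw = slotOK (second 0) refl
      (bound-via (count-concat-map-allFin (λ y → blockOf y <? (Q ∸ 2)) (λ i → pathVertex i (l i ∸ 1) ∷ pathVertex i (l i ∸ 2) ∷ [])
      (λ i → ≤-trans (≤-reflexive (count-reject (λ y → blockOf y <? (Q ∸ 2)) (pathVertex i (l i ∸ 1)) _
          (lastTwo-notBelowSecond (pathVertex i (l i ∸ 1)) (lastInner-lastTwo i)))) (TallySecond.tally-single _)))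
    (≤k-via _ 2 (solve 1 (λ m → con 1 :+ (con 3 :+ m :+ con 0) :+ con 2 := con 6 :+ m) refl m′))) Q∸2<Q

  slotOK-inner : ∀ i j → SlotOK (inner i j)
  slotOK-inner i j = dispatch (p ≤? headLen i) (l i ≤? p + tailLen i)
    where
    p : ℕ
    p = suc (toℕ j)
    p<l : p < l i
    p<l = ≤-trans (s≤s (toℕ<n j)) (≤-reflexive (suc[l∸1] i))
    dispatch : Dec (p ≤ headLen i) → Dec (l i ≤ p + tailLen i) → SlotOK (inner i j)
    dispatch (yes h) _ = slotOK (top (headOffset i p)) (pathSlot-head i p h) (headBound i p (s≤s z≤n) h) Q∸1<Q
    dispatch (no h) (yes h') = slotOK (second (tailOffset i p)) (pathSlot-tail i p (≰⇒> h) h') (tailBound i p p<l (≰⇒> h) h') Q∸2<Q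
    dispatch (no h) (no h') = dc (freeIndex i p <? th₁) (freeIndex i p <? th₂)
      where
      t1 : headLen i < p
      t1 = ≰⇒> h
      t2 : p + tailLen i < l i
      t2 = ≰⇒> h'
      e0 : slot (inner i j) ≡ freeSlot (freeIndex i p)
      e0 = pathSlot-free i p t1 t2
      dc : Dec (freeIndex i p < th₁) → Dec (freeIndex i p < th₂) → SlotOK (inner i j)
      dc (yes z) _ = slotOK _ (trans e0 (freeSlot-top _ z)) (freeTopBound i p t1 t2 z) Q∸1<Q
      dc (no z) (no z') = slotOK _ (trans e0 (freeSlot-second _ (≮⇒≥ z'))) (freeSecondBound i p t1 t2 (≮⇒≥ z')) Q∸2<Q
      dc (no z) (yes z') = slotOK _ (trans e0 (freeSlot-ranked _ (≮⇒≥ z) z')) (rankedBound i p t1 t2 (≮⇒≥ z) z')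
        (<-≤-trans (midRank-block< (freeIndex i p) (≮⇒≥ z) z') (m∸n≤m Q 2))

  slotOK-all : ∀ x → SlotOK x
  slotOK-all tu = slotOK-tu
  slotOK-all tw = slotOK-tw
  slotOK-all (inner i j) = slotOK-inner i j

  earlier-bound : ∀ x → length (filter (λ y → blockOf y <? blockOf x) (nbrs x)) + offsetOf x < k
  earlier-bound x with slotOK-all x
  ... | slotOK Z e bound _ = subst (λ Z → count (λ y → blockOf y <? slotBlock Z) (nbrs x) + slotOffset Z < k) (sym e) bound

  blockOf<Q : ∀ x → blockOf x < Q
  blockOf<Q x with slotOK-all x
  ... | slotOK Z e _ c = subst (λ Z → slotBlock Z < Q) (sym e) c

  freeVertex : ℕ → Vertex
  freeVertex = locate freeLen tu (λ i t → pathVertex i (suc (headLen i + t)))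

  freeVertex-freeIndex : ∀ i q → headLen i < q → q + tailLen i < l i → freeVertex (freeIndex i q) ≡ pathVertex i q
  freeVertex-freeIndex i q h1 h2 = trans
      (locate-prefixSum freeLen tu (λ i t → pathVertex i (suc (headLen i + t))) i (q ∸ headLen i ∸ 1) (freePos<freeLen i q h1 h2))
    (cong (pathVertex i) e)
    where
    e : suc (headLen i + (q ∸ headLen i ∸ 1)) ≡ q
    e = begin
        suc (headLen i + (q ∸ headLen i ∸ 1)) ≡⟨ sym (+-suc (headLen i) _) ⟩
        headLen i + suc (q ∸ headLen i ∸ 1) ≡⟨ cong (headLen i +_) (sp (m<n⇒0<n∸m h1)) ⟩
        headLen i + (q ∸ headLen i) ≡⟨ m+[n∸m]≡n (<⇒≤ h1) ⟩
        q ∎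
      where
      open ≡-Reasoning
      sp : ∀ {x} → 1 ≤ x → suc (x ∸ 1) ≡ x
      sp {suc x} _ = refl

  pathVertexℕ : ℕ → ℕ → Vertex
  pathVertexℕ t q with t <? m
  ... | yes h = pathVertex (fromℕ< h) q
  ... | no _ = tu

  pathVertexℕ-toℕ : ∀ i q → pathVertexℕ (toℕ i) q ≡ pathVertex i q
  pathVertexℕ-toℕ i q with toℕ i <? m
  ... | yes h = cong (λ z → pathVertex z q) (fromℕ<-toℕ i h)
  ... | no n = ⊥-elim (n (toℕ<n i))

  lastInnerℕ : ℕ → Vertex
  lastInnerℕ t with t <? m
  ... | yes h = pathVertex (fromℕ< h) (l (fromℕ< h) ∸ 1)
  ... | no _ = tu

  lastInnerℕ-toℕ : ∀ i → lastInnerℕ (toℕ i) ≡ pathVertex i (l i ∸ 1)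
  lastInnerℕ-toℕ i with toℕ i <? m
  ... | yes h = cong (λ z → pathVertex z (l z ∸ 1)) (fromℕ<-toℕ i h)
  ... | no n = ⊥-elim (n (toℕ<n i))


-- Injectivity of slots, by decoding: decodeTop o is the vertex at offset o
-- of the top block (inverting slot tu, headOffset and the top free slots),
-- decodeSecond o the one at offset o of the second block, and decodeRanked r
-- the free vertex of rank r.  Together with the fact that ranks lie below
-- block Q ∸ 2, this shows that distinct vertices get distinct slots.
module Decode (m′ : ℕ) (l : Fin (suc (suc (suc m′))) → ℕ)
  (mono : ∀ i j → toℕ i ≤ toℕ j → l i ≤ l j)
  (l₀≥2 : 2 ≤ l zero) (l₁≥4 : 4 ≤ l (suc zero))
  (k1 : ℕ) (k≥m+3 : 6 + m′ ≤ suc k1)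
  where

  open Scheme m′ l mono l₀≥2 l₁≥4 k1 k≥m+3 public
  open +-*-Solver using (solve; _:+_; _:=_; con)

  k1≥m+2 : 5 + m′ ≤ k1
  k1≥m+2 = ≤-pred k≥m+3

  -- Offsets of the top block: 0, k ∸ 2, k ∸ 1 on path 1; 1 for u; 2 on
  -- path 0; 3 … m for the second vertices of paths 2 … m ∸ 1; then the free
  -- vertices from m + 1 on.
  decodeTop : ℕ → Vertex
  decodeTop o with o ≟ 0
  ... | yes _ = pathVertex i1 3
  ... | no _ with o ≟ 1
  ... | yes _ = tu
  ... | no _ with o ≟ 2
  ... | yes _ = pathVertex i0 1
  ... | no _ with o ≤? m
  ... | yes _ = pathVertexℕ (o ∸ 1) 1
  ... | no _ with o ≤? k1 ∸ 2
  ... | yes _ = freeVertex (o ∸ (4 + m′))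
  ... | no _ with o ≟ k1 ∸ 1
  ... | yes _ = pathVertex i1 2
  ... | no _ = pathVertex i1 1

  decodeTop-first : ∀ o → 3 ≤ o → o ≤ m → decodeTop o ≡ pathVertexℕ (o ∸ 1) 1
  decodeTop-first o h1 h2 with o ≟ 0
  ... | yes e = ⊥-elim (<⇒≱ h1 (≤-trans (≤-reflexive e) z≤n))
  ... | no _ with o ≟ 1
  ... | yes e = ⊥-elim (<⇒≱ h1 (≤-trans (≤-reflexive e) (s≤s z≤n)))
  ... | no _ with o ≟ 2
  ... | yes e = ⊥-elim (<⇒≱ h1 (≤-reflexive e))
  ... | no _ with o ≤? m
  ... | yes _ = refl
  ... | no n = ⊥-elim (n h2)

  decodeTop-free : ∀ o → m < o → o ≤ k1 ∸ 2 → decodeTop o ≡ freeVertex (o ∸ (4 + m′))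
  decodeTop-free o h1 h2 with o ≟ 0
  ... | yes e = ⊥-elim (<⇒≱ h1 (≤-trans (≤-reflexive e) z≤n))
  ... | no _ with o ≟ 1
  ... | yes e = ⊥-elim (<⇒≱ h1 (≤-trans (≤-reflexive e) (s≤s z≤n)))
  ... | no _ with o ≟ 2
  ... | yes e = ⊥-elim (<⇒≱ h1 (≤-trans (≤-reflexive e) (s≤s (s≤s z≤n))))
  ... | no _ with o ≤? m
  ... | yes y = ⊥-elim (<⇒≱ h1 y)
  ... | no _ with o ≤? k1 ∸ 2
  ... | yes _ = refl
  ... | no n = ⊥-elim (n h2)

  m+2≤k1 : m + 2 ≤ k1
  m+2≤k1 = ≤-trans (≤-reflexive (solve 1 (λ m → con 3 :+ m :+ con 2 := con 5 :+ m) refl m′)) k1≥m+2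

  m<k1∸1 : suc m ≤ k1 ∸ 1
  m<k1∸1 = ≤-trans (≤-reflexive (sym (trans (+-∸-assoc m {2} {1} (s≤s z≤n)) (+-comm m 1)))) (∸-monoˡ-≤ 1 m+2≤k1)

  k1∸1≢small : ∀ x → x ≤ m → k1 ∸ 1 ≢ x
  k1∸1≢small x h e = <⇒≱ (≤-trans (s≤s h) m<k1∸1) (≤-reflexive e)

  k1≥2 : 2 ≤ k1
  k1≥2 = ≤-trans (s≤s (s≤s z≤n)) k1≥m+2

  ∸2<∸1 : ∀ x → 2 ≤ x → x ∸ 2 < x ∸ 1
  ∸2<∸1 (suc (suc x)) _ = ≤-refl
  ∸2<∸1 zero ()
  ∸2<∸1 (suc zero) (s≤s ())

  decodeTop-k∸2 : decodeTop (k1 ∸ 1) ≡ pathVertex i1 2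
  decodeTop-k∸2 with (k1 ∸ 1) ≟ 0
  ... | yes e = ⊥-elim (k1∸1≢small 0 z≤n e)
  ... | no _ with (k1 ∸ 1) ≟ 1
  ... | yes e = ⊥-elim (k1∸1≢small 1 (s≤s z≤n) e)
  ... | no _ with (k1 ∸ 1) ≟ 2
  ... | yes e = ⊥-elim (k1∸1≢small 2 (s≤s (s≤s z≤n)) e)
  ... | no _ with (k1 ∸ 1) ≤? m
  ... | yes y = ⊥-elim (<⇒≱ m<k1∸1 y)
  ... | no _ with (k1 ∸ 1) ≤? k1 ∸ 2
  ... | yes y = ⊥-elim (<⇒≱ (∸2<∸1 k1 k1≥2) y)
  ... | no _ with (k1 ∸ 1) ≟ k1 ∸ 1
  ... | yes _ = refl
  ... | no n = ⊥-elim (n refl)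

  m<k1 : suc m ≤ k1
  m<k1 = ≤-trans m<k1∸1 (m∸n≤m k1 1)

  decodeTop-k∸1 : decodeTop k1 ≡ pathVertex i1 1
  decodeTop-k∸1 with k1 ≟ 0
  ... | yes e = ⊥-elim (<⇒≱ m<k1 (≤-trans (≤-reflexive e) z≤n))
  ... | no _ with k1 ≟ 1
  ... | yes e = ⊥-elim (<⇒≱ m<k1 (≤-trans (≤-reflexive e) (s≤s z≤n)))
  ... | no _ with k1 ≟ 2
  ... | yes e = ⊥-elim (<⇒≱ m<k1 (≤-trans (≤-reflexive e) (s≤s (s≤s z≤n))))
  ... | no _ with k1 ≤? m
  ... | yes y = ⊥-elim (<⇒≱ m<k1 y)
  ... | no _ with k1 ≤? k1 ∸ 2
  ... | yes y = ⊥-elim (<⇒≱ (<-≤-trans (∸2<∸1 k1 k1≥2) (m∸n≤m k1 1)) y)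
  ... | no _ with k1 ≟ k1 ∸ 1
  ... | yes e = ⊥-elim (<⇒≱ (sub1 k1 (≤-trans (s≤s z≤n) k1≥2)) (≤-reflexive e))
    where sub1 : ∀ x → 1 ≤ x → x ∸ 1 < x
          sub1 (suc x) _ = ≤-refl
  ... | no _ = refl

  ≤1⇒0or1 : ∀ x → x ≤ 1 → x ≡ 0 ⊎ x ≡ 1
  ≤1⇒0or1 zero _ = inj₁ refl
  ≤1⇒0or1 (suc zero) _ = inj₂ refl
  ≤1⇒0or1 (suc (suc x)) (s≤s ())

  -- The tail vertices of paths 0 and 1 (present iff δ₀ = 1, resp. δ₁ = 1)
  -- and the third-to-last inner vertex of path 2 occupy consecutive offsets
  -- of the second block, starting at m ∸ 2.
  ifOne : ℕ → List Vertex → List Vertex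
  ifOne (suc zero) xs = xs
  ifOne _ xs = []

  nth : List Vertex → ℕ → Vertex
  nth [] _ = tu
  nth (x ∷ _) zero = x
  nth (_ ∷ xs) (suc n) = nth xs n

  tailVertex₀ tailVertex₁ tailVertex₂ : Vertex
  tailVertex₀ = pathVertex i0 (l i0 ∸ 1)
  tailVertex₁ = pathVertex i1 (l i1 ∸ 1)
  tailVertex₂ = pathVertex i2 (l i2 ∸ 3)

  optionalTails : ℕ → ℕ → List Vertex
  optionalTails x y = ifOne x (tailVertex₀ ∷ []) ++ ifOne y (tailVertex₁ ∷ []) ++ (tailVertex₂ ∷ [])

  tailList : List Vertex
  tailList = optionalTails δ₀ δ₁

  δ₁≤1 : δ₁ ≤ 1
  δ₁≤1 = ind≥5≤1 (l i1)

  tailList-0 : δ₀ ≡ 1 → nth tailList 0 ≡ tailVertex₀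
  tailList-0 e = go δ₀ e δ₁
    where
    go : ∀ x → x ≡ 1 → ∀ y → nth (optionalTails x y) 0 ≡ tailVertex₀
    go .1 refl y = refl

  tailList-1 : δ₁ ≡ 1 → nth tailList δ₀ ≡ tailVertex₁
  tailList-1 e = go δ₀ (≤1⇒0or1 δ₀ δ₀≤1) δ₁ e
    where
    go : ∀ x → x ≡ 0 ⊎ x ≡ 1 → ∀ y → y ≡ 1 → nth (optionalTails x y) x ≡ tailVertex₁
    go .0 (inj₁ refl) .1 refl = refl
    go .1 (inj₂ refl) .1 refl = refl

  tailList-2 : nth tailList (δ₀ + δ₁) ≡ tailVertex₂
  tailList-2 = go δ₀ (≤1⇒0or1 δ₀ δ₀≤1) δ₁ (≤1⇒0or1 δ₁ δ₁≤1)
    where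
    go : ∀ x → x ≡ 0 ⊎ x ≡ 1 → ∀ y → y ≡ 0 ⊎ y ≡ 1 → nth (optionalTails x y) (x + y) ≡ tailVertex₂
    go .0 (inj₁ refl) .0 (inj₁ refl) = refl
    go .0 (inj₁ refl) .1 (inj₂ refl) = refl
    go .1 (inj₂ refl) .0 (inj₁ refl) = refl
    go .1 (inj₂ refl) .1 (inj₂ refl) = refl

  -- Offsets of the second block: 0 for w; 1 … m ∸ 3 for the last inner
  -- vertices of paths 3 … m ∸ 1; then tailList; from secondBase on the free
  -- vertices; k ∸ 2 and k ∸ 1 for the last two inner vertices of path 2.
  decodeSecond : ℕ → Vertex
  decodeSecond o with o ≟ 0
  ... | yes _ = tw
  ... | no _ with o ≤? m′
  ... | yes _ = lastInnerℕ (o + 2)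
  ... | no _ with o <? secondBase
  ... | yes _ = nth tailList (o ∸ suc m′)
  ... | no _ with o ≤? k1 ∸ 2
  ... | yes _ = freeVertex (th₂ + (o ∸ secondBase))
  ... | no _ with o ≟ k1 ∸ 1
  ... | yes _ = pathVertex i2 (l i2 ∸ 2)
  ... | no _ = pathVertex i2 (l i2 ∸ 1)

  decodeSecond-last : ∀ o → 1 ≤ o → o ≤ m′ → decodeSecond o ≡ lastInnerℕ (o + 2)
  decodeSecond-last o h1 h2 with o ≟ 0
  ... | yes e = ⊥-elim (<⇒≱ h1 (≤-reflexive e))
  ... | no _ with o ≤? m′
  ... | yes _ = refl
  ... | no n = ⊥-elim (n h2)

  decodeSecond-optional : ∀ o → suc m′ ≤ o → o < secondBase → decodeSecond o ≡ nth tailList (o ∸ suc m′)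
  decodeSecond-optional o h1 h2 with o ≟ 0
  ... | yes e = ⊥-elim (<⇒≱ h1 (≤-trans (≤-reflexive e) z≤n))
  ... | no _ with o ≤? m′
  ... | yes y = ⊥-elim (<⇒≱ h1 y)
  ... | no _ with o <? secondBase
  ... | yes _ = refl
  ... | no n = ⊥-elim (n h2)

  secondBase≤m+1 : secondBase ≤ suc m
  secondBase≤m+1 = ≤-trans (+-mono-≤ (+-mono-≤ (+-monoʳ-≤ (suc m′) δ₀≤1) δ₁≤1) (ind≥5≤1 (l i2)))
    (≤-reflexive (solve 1 (λ m → con 1 :+ m :+ con 1 :+ con 1 :+ con 1 := con 4 :+ m) refl m′))

  m'<secondBase : suc m′ ≤ secondBase
  m'<secondBase = ≤-trans (m≤m+n (suc m′) δ₀) (≤-trans (m≤m+n _ δ₁) (m≤m+n _ δ₂))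

  decodeSecond-free : ∀ o → secondBase ≤ o → o ≤ k1 ∸ 2 → decodeSecond o ≡ freeVertex (th₂ + (o ∸ secondBase))
  decodeSecond-free o h1 h2 with o ≟ 0
  ... | yes e = ⊥-elim (<⇒≱ (s≤s z≤n) (≤-trans h1 (≤-reflexive e)))
  ... | no _ with o ≤? m′
  ... | yes y = ⊥-elim (<⇒≱ (≤-trans m'<secondBase h1) y)
  ... | no _ with o <? secondBase
  ... | yes y = ⊥-elim (<⇒≱ y h1)
  ... | no _ with o ≤? k1 ∸ 2
  ... | yes _ = refl
  ... | no n = ⊥-elim (n h2)

  secondBase≤k1∸1 : secondBase ≤ k1 ∸ 1
  secondBase≤k1∸1 = ≤-trans secondBase≤m+1 m<k1∸1

  decodeSecond-k∸2 : decodeSecond (k1 ∸ 1) ≡ pathVertex i2 (l i2 ∸ 2)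
  decodeSecond-k∸2 with (k1 ∸ 1) ≟ 0
  ... | yes e = ⊥-elim (k1∸1≢small 0 z≤n e)
  ... | no _ with (k1 ∸ 1) ≤? m′
  ... | yes y = ⊥-elim (<⇒≱ (≤-trans (s≤s (≤-trans (n≤1+n m′) (≤-trans (n≤1+n _) (n≤1+n _)))) m<k1∸1) y)
  ... | no _ with (k1 ∸ 1) <? secondBase
  ... | yes y = ⊥-elim (<⇒≱ y secondBase≤k1∸1)
  ... | no _ with (k1 ∸ 1) ≤? k1 ∸ 2
  ... | yes y = ⊥-elim (<⇒≱ (∸2<∸1 k1 k1≥2) y)
  ... | no _ with (k1 ∸ 1) ≟ k1 ∸ 1
  ... | yes _ = refl
  ... | no n = ⊥-elim (n refl)

  decodeSecond-k∸1 : decodeSecond k1 ≡ pathVertex i2 (l i2 ∸ 1)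
  decodeSecond-k∸1 with k1 ≟ 0
  ... | yes e = ⊥-elim (<⇒≱ m<k1 (≤-trans (≤-reflexive e) z≤n))
  ... | no _ with k1 ≤? m′
  ... | yes y = ⊥-elim (<⇒≱ (≤-trans (s≤s (≤-trans (n≤1+n m′) (≤-trans (n≤1+n _) (n≤1+n _)))) m<k1) y)
  ... | no _ with k1 <? secondBase
  ... | yes y = ⊥-elim (<⇒≱ y (≤-trans secondBase≤k1∸1 (m∸n≤m k1 1)))
  ... | no _ with k1 ≤? k1 ∸ 2
  ... | yes y = ⊥-elim (<⇒≱ (<-≤-trans (∸2<∸1 k1 k1≥2) (m∸n≤m k1 1)) y)
  ... | no _ with k1 ≟ k1 ∸ 1
  ... | yes e = ⊥-elim (<⇒≱ (sub1 k1 (≤-trans (s≤s z≤n) k1≥2)) (≤-reflexive e))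
    where sub1 : ∀ x → 1 ≤ x → x ∸ 1 < x
          sub1 (suc x) _ = ≤-refl
  ... | no _ = refl

  decodeRanked : ℕ → Vertex
  decodeRanked r = freeVertex (th₁ + (r ∸ midBase))

  decodeSlot : Slot → Vertex
  decodeSlot (top o)    = decodeTop o
  decodeSlot (second o) = decodeSecond o
  decodeSlot (ranked r) = decodeRanked r

  Admissible : Slot → Set
  Admissible (ranked r) = r / k < Q ∸ 2
  Admissible _          = ⊤

  record Decodes (x : Vertex) : Set where
    constructor decodes
    field
      decoded    : decodeSlot (slot x) ≡ x
      admissible : Admissible (slot x)

  decodes-via : ∀ x Z → slot x ≡ Z → decodeSlot Z ≡ x → Admissible Z → Decodes x
  decodes-via x Z slot≡ decode≡ adm = decodes (trans (cong decodeSlot slot≡) decode≡) (subst Admissible (sym slot≡) adm)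

  decodeTop-head : ∀ i p → 1 ≤ p → p ≤ headLen i → decodeTop (headOffset i p) ≡ pathVertex i p
  decodeTop-head zero (suc zero) _ _ = refl
  decodeTop-head zero (suc (suc p)) _ (s≤s ())
  decodeTop-head (suc zero) (suc zero) _ _ = decodeTop-k∸1
  decodeTop-head (suc zero) (suc (suc zero)) _ _ = decodeTop-k∸2
  decodeTop-head (suc zero) (suc (suc (suc zero))) _ _ = refl
  decodeTop-head (suc zero) (suc (suc (suc (suc p)))) _ (s≤s (s≤s (s≤s ())))
  decodeTop-head (suc (suc i)) (suc zero) _ _ = trans (decodeTop-first (3 + toℕ i) (s≤s (s≤s (s≤s z≤n))) (s≤s (s≤s (s≤s (≤-pred (toℕ<n i))))))
    (pathVertexℕ-toℕ (suc (suc i)) 1)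
  decodeTop-head (suc (suc i)) (suc (suc p)) _ (s≤s ())
  decodeTop-head _ zero () _

  decodeSecond-thirdLast : ∀ p → p < l i2 → suc p ≢ l i2 → suc (suc p) ≢ l i2 → l i2 ≤ p + tailLen i2 →
    decodeSecond (tailOffset i2 p) ≡ pathVertex i2 p
  decodeSecond-thirdLast p p<l ne ne₂ hs = begin
      decodeSecond (tailOffset i2 p)           ≡⟨ cong decodeSecond (tailOffset₂-thirdLast p ne ne₂) ⟩
      decodeSecond (suc m′ + δ₀ + δ₁)          ≡⟨ decodeSecond-optional (suc m′ + δ₀ + δ₁)
                                                    (≤-trans (m≤m+n (suc m′) δ₀) (m≤m+n _ δ₁))
                                                    (≤-trans (≤-reflexive (+-comm 1 (suc m′ + δ₀ + δ₁))) (+-monoʳ-≤ _ δ₂≥1)) ⟩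
      nth tailList (suc m′ + δ₀ + δ₁ ∸ suc m′) ≡⟨ cong (nth tailList) (trans (cong (_∸ suc m′) (+-assoc (suc m′) δ₀ δ₁))
                                                    (m+n∸m≡n (suc m′) (δ₀ + δ₁))) ⟩
      nth tailList (δ₀ + δ₁)                   ≡⟨ tailList-2 ⟩
      pathVertex i2 (l i2 ∸ 3)                 ≡⟨ cong (pathVertex i2) (cong (_∸ 3) (sym p+3≡l)) ⟩
      pathVertex i2 p                          ∎
    where
    open ≡-Reasoning
    p+3≤l : suc (suc (suc p)) ≤ l i2
    p+3≤l = ≤∧≢⇒< (≤∧≢⇒< p<l ne) ne₂
    δ₂≥1 : 1 ≤ δ₂
    δ₂≥1 = ≤-pred (≤-pred (+-cancelˡ-≤ p 3 (2 + δ₂) (≤-trans (≤-reflexive (+-comm p 3)) (≤-trans p+3≤l hs))))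
    p+3≡l : suc (suc (suc p)) ≡ l i2
    p+3≡l = ≤-antisym p+3≤l (≤-trans hs (≤-trans (+-monoʳ-≤ p (+-monoʳ-≤ 2 (ind≥5≤1 (l i2)))) (≤-reflexive (+-comm p 3))))

  decodeSecond-tail : ∀ i p → p < l i → headLen i < p → l i ≤ p + tailLen i →
    decodeSecond (tailOffset i p) ≡ pathVertex i p
  decodeSecond-tail zero p lt ht hs = trans
      (decodeSecond-optional (suc m′) ≤-refl
        (≤-trans (≤-reflexive (+-comm 1 (suc m′))) (≤-trans (+-monoʳ-≤ (suc m′) (≤-reflexive (sym δ₀≡1)))
          (≤-trans (m≤m+n _ δ₁) (m≤m+n _ δ₂)))))
      (trans (cong (nth tailList) (n∸n≡0 (suc m′))) (trans (tailList-0 δ₀≡1) (cong (pathVertex i0) (sym (cong (_∸ 1) isLast)))))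
    where
    isLast : suc p ≡ l zero
    isLast = last-position (l zero) p _ lt hs (ind≥3≤1 (l zero))
    δ₀≡1 : δ₀ ≡ 1
    δ₀≡1 = ≤-antisym δ₀≤1 (ind≥3-pos (l zero) (subst (λ z → 1 < z ∸ 1) isLast ht))
  decodeSecond-tail (suc zero) p lt ht hs = trans
      (decodeSecond-optional (suc m′ + δ₀) (m≤m+n (suc m′) δ₀)
        (≤-trans (≤-reflexive (+-comm 1 (suc m′ + δ₀))) (≤-trans (+-monoʳ-≤ (suc m′ + δ₀) (≤-reflexive (sym δ₁≡1)))
          (m≤m+n _ δ₂))))
      (trans (cong (nth tailList) (m+n∸m≡n (suc m′) δ₀))
        (trans (tailList-1 δ₁≡1) (cong (pathVertex i1) (sym (cong (_∸ 1) isLast)))))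
    where
    isLast : suc p ≡ l i1
    isLast = last-position (l i1) p _ lt hs (ind≥5≤1 (l i1))
    δ₁≡1 : δ₁ ≡ 1
    δ₁≡1 = ≤-antisym δ₁≤1 (ind≥5-pos (l i1) (subst (λ z → 3 < z ∸ 1) isLast ht))
  decodeSecond-tail (suc (suc (suc i))) p lt ht hs = trans (decodeSecond-last (suc (toℕ i)) (s≤s z≤n) (toℕ<n i))
    (trans (cong lastInnerℕ (+-comm (suc (toℕ i)) 2))
      (trans (lastInnerℕ-toℕ (suc (suc (suc i)))) (cong (pathVertex (suc (suc (suc i)))) (sym (cong (_∸ 1) isLast)))))
    where
    isLast : suc p ≡ l (suc (suc (suc i)))
    isLast = last-position (l (suc (suc (suc i)))) p 1 lt hs ≤-refl
  decodeSecond-tail (suc (suc zero)) p lt ht hs = byPosition (suc p ≟ l i2) (suc (suc p) ≟ l i2)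
    where
    byPosition : Dec (suc p ≡ l i2) → Dec (suc (suc p) ≡ l i2) → decodeSecond (tailOffset i2 p) ≡ pathVertex i2 p
    byPosition (yes e) _ = trans (cong decodeSecond (tailOffset₂-last p e))
      (trans decodeSecond-k∸1 (cong (pathVertex i2) (sym (cong (_∸ 1) e))))
    byPosition (no ne) (yes e) = trans (cong decodeSecond (tailOffset₂-secondLast p ne e))
      (trans decodeSecond-k∸2 (cong (pathVertex i2) (cong (_∸ 2) (sym e))))
    byPosition (no ne) (no ne₂) = decodeSecond-thirdLast p lt ne ne₂ hs

  decodeTop-freeSlot : ∀ c → c < th₁ → decodeTop (4 + m′ + c) ≡ freeVertex c
  decodeTop-freeSlot c c<th₁ =
    trans (decodeTop-free (4 + m′ + c) (s≤s (s≤s (s≤s (s≤s (m≤m+n m′ c))))) (∸-monoˡ-≤ 2 6+m′+c≤k1))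
          (cong freeVertex (m+n∸m≡n (4 + m′) c))
    where
    6+m′+c≤k1 : 6 + m′ + c ≤ k1
    6+m′+c≤k1 = ≤-pred (begin-strict
        6 + m′ + c       <⟨ +-monoʳ-< (6 + m′) (<-≤-trans c<th₁ th₁≤topRoom) ⟩
        6 + m′ + topRoom ≡⟨ m+[n∸m]≡n k≥m+3 ⟩
        k                ∎)
      where open ≤-Reasoning

  secondFreeOffset≤ : ∀ c → th₂ ≤ c → c < freeTotal → secondBase + (c ∸ th₂) ≤ k1 ∸ 2
  secondFreeOffset≤ c th₂≤c c<total = subst (_≤ k1 ∸ 2) (m+n∸n≡m (secondBase + x) 2) (∸-monoˡ-≤ 2 offset+2≤k1)
    where
    x : ℕ
    x = c ∸ th₂
    x<room : x < secondRoom
    x<room = <-≤-trans (∸-monoˡ-< c<total th₂≤c) (≤-trans (≤-reflexive freeTotal∸th₂) secondFree≤secondRoom)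
    offset+2≤k1 : secondBase + x + 2 ≤ k1
    offset+2≤k1 = ≤-pred (begin-strict
        secondBase + x + 2          ≡⟨ solve 2 (λ b x → b :+ x :+ con 2 := b :+ con 2 :+ x) refl secondBase x ⟩
        secondBase + 2 + x          <⟨ +-monoʳ-< (secondBase + 2) x<room ⟩
        secondBase + 2 + secondRoom ≡⟨ m+[n∸m]≡n secondBase+2≤k ⟩
        k                           ∎)
      where open ≤-Reasoning

  decodeSecond-freeSlot : ∀ c → th₂ ≤ c → c < freeTotal → decodeSecond (secondBase + (c ∸ th₂)) ≡ freeVertex c
  decodeSecond-freeSlot c th₂≤c c<total = begin
      decodeSecond (secondBase + (c ∸ th₂))
        ≡⟨ decodeSecond-free (secondBase + (c ∸ th₂)) (m≤m+n secondBase _) (secondFreeOffset≤ c th₂≤c c<total) ⟩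
      freeVertex (th₂ + (secondBase + (c ∸ th₂) ∸ secondBase))
        ≡⟨ cong (λ w → freeVertex (th₂ + w)) (m+n∸m≡n secondBase (c ∸ th₂)) ⟩
      freeVertex (th₂ + (c ∸ th₂))
        ≡⟨ cong freeVertex (m+[n∸m]≡n th₂≤c) ⟩
      freeVertex c ∎
    where open ≡-Reasoning

  decodeRanked-midRank : ∀ c → th₁ ≤ c → decodeRanked (midRank c) ≡ freeVertex c
  decodeRanked-midRank c th₁≤c =
    trans (cong (λ w → freeVertex (th₁ + w)) (m+n∸m≡n midBase (c ∸ th₁))) (cong freeVertex (m+[n∸m]≡n th₁≤c))

  decodeSlot-freeSlot : ∀ c → c < freeTotal → decodeSlot (freeSlot c) ≡ freeVertex c × Admissible (freeSlot c)
  decodeSlot-freeSlot c c<total with c <? th₁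
  ... | yes c<th₁ = decodeTop-freeSlot c c<th₁ , tt
  ... | no c≮th₁ with c <? th₂
  ... | yes c<th₂ = decodeRanked-midRank c (≮⇒≥ c≮th₁) , midRank-block< c (≮⇒≥ c≮th₁) c<th₂
  ... | no c≮th₂ = decodeSecond-freeSlot c (≮⇒≥ c≮th₂) c<total , tt

  decodes-inner : ∀ i j → Decodes (inner i j)
  decodes-inner i j = byKind (p ≤? headLen i) (l i ≤? p + tailLen i)
    where
    p : ℕ
    p = suc (toℕ j)
    p<l : p < l i
    p<l = ≤-trans (s≤s (toℕ<n j)) (≤-reflexive (suc[l∸1] i))
    p≡ : pathVertex i p ≡ inner i j
    p≡ = pathVertex-inner i j
    byKind : Dec (p ≤ headLen i) → Dec (l i ≤ p + tailLen i) → Decodes (inner i j)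
    byKind (yes inHead) _ = decodes-via (inner i j) (top (headOffset i p)) (pathSlot-head i p inHead)
      (trans (decodeTop-head i p (s≤s z≤n) inHead) p≡) tt
    byKind (no notHead) (yes inTail) = decodes-via (inner i j) (second (tailOffset i p)) (pathSlot-tail i p (≰⇒> notHead) inTail)
      (trans (decodeSecond-tail i p p<l (≰⇒> notHead) inTail) p≡) tt
    byKind (no notHead) (no notTail) = decodes-via (inner i j) (freeSlot (freeIndex i p))
      (pathSlot-free i p head<p p+tail<l)
      (trans (proj₁ decoded) (trans (freeVertex-freeIndex i p head<p p+tail<l) p≡)) (proj₂ decoded)
      where
      head<p : headLen i < p
      head<p = ≰⇒> notHead
      p+tail<l : p + tailLen i < l i
      p+tail<l = ≰⇒> notTail
      decoded : decodeSlot (freeSlot (freeIndex i p)) ≡ freeVertex (freeIndex i p) × Admissible (freeSlot (freeIndex i p))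
      decoded = decodeSlot-freeSlot (freeIndex i p) (freeIndex<freeTotal i p head<p p+tail<l)

  decodes-all : ∀ x → Decodes x
  decodes-all tu = decodes refl tt
  decodes-all tw = decodes refl tt
  decodes-all (inner i j) = decodes-inner i j

  module _ (Q≥2 : 2 ≤ Q) where

    Q∸1≢Q∸2 : Q ∸ 1 ≢ Q ∸ 2
    Q∸1≢Q∸2 = go Q Q≥2
      where
      go : ∀ q → 2 ≤ q → q ∸ 1 ≢ q ∸ 2
      go (suc (suc q)) _ e = <-irrefl (sym e) ≤-refl
      go (suc zero) (s≤s ()) e
      go zero () e

    slotPosition-injective : ∀ Z Z′ → Admissible Z → Admissible Z′ →
      slotBlock Z ≡ slotBlock Z′ → slotOffset Z ≡ slotOffset Z′ → Z ≡ Z′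
    slotPosition-injective (top o)    (top o′)    _ _ _ o≡ = cong top o≡
    slotPosition-injective (second o) (second o′) _ _ _ o≡ = cong second o≡
    slotPosition-injective (ranked r) (ranked r′) _ _ b≡ o≡ = cong ranked (begin
        r                 ≡⟨ m≡m%n+[m/n]*n r k ⟩
        r % k + r / k * k ≡⟨ cong₂ (λ u v → u + v * k) o≡ b≡ ⟩
        r′ % k + r′ / k * k ≡⟨ sym (m≡m%n+[m/n]*n r′ k) ⟩
        r′                ∎)
      where open ≡-Reasoning
    slotPosition-injective (top _)    (second _)  _ _ b≡ _ = ⊥-elim (Q∸1≢Q∸2 b≡)
    slotPosition-injective (second _) (top _)     _ _ b≡ _ = ⊥-elim (Q∸1≢Q∸2 (sym b≡))
    slotPosition-injective (top _)    (ranked _)  _ a b≡ _ = ⊥-elim (<⇒≱ a (≤-trans (∸-monoʳ-≤ Q (n≤1+n 1)) (≤-reflexive b≡)))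
    slotPosition-injective (ranked _) (top _)     a _ b≡ _ = ⊥-elim (<⇒≱ a (≤-trans (∸-monoʳ-≤ Q (n≤1+n 1)) (≤-reflexive (sym b≡))))
    slotPosition-injective (second _) (ranked _)  _ a b≡ _ = ⊥-elim (<⇒≱ a (≤-reflexive b≡))
    slotPosition-injective (ranked _) (second _)  a _ b≡ _ = ⊥-elim (<⇒≱ a (≤-reflexive (sym b≡)))

    slot-injective : ∀ x y → blockOf x ≡ blockOf y → offsetOf x ≡ offsetOf y → x ≡ y
    slot-injective x y b≡ o≡ = begin
        x                   ≡⟨ sym (Decodes.decoded (decodes-all x)) ⟩
        decodeSlot (slot x) ≡⟨ cong decodeSlot (slotPosition-injective (slot x) (slot y)
                                 (Decodes.admissible (decodes-all x)) (Decodes.admissible (decodes-all y)) b≡ o≡) ⟩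
        decodeSlot (slot y) ≡⟨ Decodes.decoded (decodes-all y) ⟩
        y                   ∎
      where open ≡-Reasoning

  -- For k < n the last two blocks differ, so slots are injective, and the
  -- scheme is a block schedule with ⌈ n / k ⌉ blocks.
  thetaSchedule : k < order → BlockSchedule G k
  thetaSchedule k<n = record
    { blocks = Q ; block = blockOf ; offset = offsetOf ; block<blocks = blockOf<Q
    ; slot-injective = slot-injective (Q≥2 k<n) ; nbrs = nbrs ; nbrs-complete = nbrs-complete
    ; earlier-bound = earlier-bound }

  schedule : Σ (BlockSchedule G k) λ S → BlockSchedule.blocks S ≤ ⌈ order / k ⌉
  schedule with k <? order
  ... | yes k<n = thetaSchedule k<n , ≤-refl
  ... | no  k≮n = smallSchedule k (≮⇒≥ k≮n) , Q≥1
    where open SmallTheta m l l≥2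

theorem3p2 : (m : ℕ) (l : Fin m → ℕ) → 3 ≤ m →
    (∀ i j → toℕ i ≤ toℕ j → l i ≤ l j) →
    (∀ i → toℕ i ≡ 0 → 2 ≤ l i) →
    (∀ i → toℕ i ≡ 1 → 4 ≤ l i) →
    (k : ℕ) → m + 3 ≤ k → EquitablyChoosable (square (Theta m l)) k
theorem3p2 (suc (suc (suc m′))) l (s≤s (s≤s (s≤s _))) mono l₀≥2 l₁≥4 zero ()
theorem3p2 (suc (suc (suc m′))) l (s≤s (s≤s (s≤s _))) mono l₀≥2 l₁≥4 (suc k1) m+3≤k =
  schedule⇒equitablyChoosable G (suc k1) enumerated distinct loopless (proj₁ schedule) (proj₂ schedule)
  where
  open Decode m′ l mono (l₀≥2 zero refl) (l₁≥4 (suc zero) refl) k1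
    (subst (_≤ suc k1) (cong (3 +_) (+-comm m′ 3)) m+3≤k)
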